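{- Let $n\ge 0$ and $M,N\in\mathcal{M}(n)$. Then $cr(\mathcal{T}(M,l))=ne(\mathcal{T}(N,l))$ (as multisets) for every $l\ge 0$ if and only if $M=M_n=\{\{1,2n\},\{2,2n-1\},\dots,\{n,n+1\}\}$ and $N=N_n=\{\{1,2\},\{3,4\},\dots,\{2n-1,2n\}\}$.
   Context: A matching on $[2n]$ is a partition of $[2n]$ into $n$ two-element blocks (edges); $\mathcal{M}(n)$ is the set of such matchings, $\mathcal{M}(0)=\{\emptyset\}$. Edges $A,B$ cross if $\min A<\min B<\max A<\max B$ or vice versa, and are nested if $\min A<\min B<\max B<\max A$ or vice versa; $cr(M),ne(M)$ count crossing and nested pairs. For $M\in\mathcal{M}(m)$, its children are the matchings obtained by choosing $x\in\{2,\dots,2m+2\}$, relabeling the vertices of $M$ order-preservingly by $\{2,\dots,2m+2\}\setminus\{x\}$ and adding the edge $\{1,x\}$. $\mathcal{T}(M,0)=\{M\}$ and $\mathcal{T}(M,l+1)$ is the set of children of members of $\mathcal{T}(M,l)$. For a statistic $f$ and set $Z$, $f(Z)$ is the multiset of values on $Z$ with multiplicities. -}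

module Defs where

open import Data.Nat using (ℕ; zero; suc; _+_; _*_; _∸_; _<_; _<ᵇ_)
open import Data.Bool using (Bool; true; false; if_then_else_; _∧_)
open import Data.List using (List; []; _∷_; _++_; map; concatMap; upTo; take; drop; length; filter)
open import Data.Nat.ListAction using (sum)
open import Data.Product using (_×_; _,_)
open import Relation.Binary.PropositionalEquality using (_≡_; _≢_)

-- Representation: vertices of [2n] are written 0-based as 0,…,2n-1
-- (vertex v here is vertex v+1 of the paper).  A matching is stored
-- as its partner list p : List ℕ, where the i-th entry is the partner of i.

-- safe lookup (default 0; only used at valid indices)
at : List ℕ → ℕ → ℕ
at []       _       = 0
at (x ∷ _)  zero    = x
at (_ ∷ xs) (suc i) = at xs i

record IsMatching (n : ℕ) (p : List ℕ) : Set where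
  field
    len     : length p ≡ 2 * n
    inRange : ∀ i → i < 2 * n → at p i < 2 * n
    noFix   : ∀ i → i < 2 * n → at p i ≢ i
    invol   : ∀ i → i < 2 * n → at p (at p i) ≡ i

edges : List ℕ → List (ℕ × ℕ)
edges p = map (λ i → (i , at p i)) (filter (λ i → Data.Nat._<?_ i (at p i)) (upTo (length p)))

count : {A : Set} → (A → Bool) → List A → ℕ
count f []       = 0
count f (x ∷ xs) = (if f x then 1 else 0) + count f xs

pairCount : (ℕ × ℕ → ℕ × ℕ → Bool) → List ℕ → ℕ
pairCount r p = sum (map (λ e → count (r e) (edges p)) (edges p))

crosses : ℕ × ℕ → ℕ × ℕ → Bool
crosses (a , b) (c , d) = (a <ᵇ c) ∧ (c <ᵇ b) ∧ (b <ᵇ d)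

nests : ℕ × ℕ → ℕ × ℕ → Bool
nests (a , b) (c , d) = (a <ᵇ c) ∧ (c <ᵇ d) ∧ (d <ᵇ b)

cr : List ℕ → ℕ
cr = pairCount crosses

ne : List ℕ → ℕ
ne = pairCount nests

-- Child of p obtained with new edge {0, k+1} (0-based; paper: {1, x}, x = k+2).
-- Old vertex v is relabelled to v+1 if v < k and to v+2 otherwise.
shiftAt : ℕ → ℕ → ℕ
shiftAt k v = if v <ᵇ k then suc v else suc (suc v)

child : List ℕ → ℕ → List ℕ
child p k = suc k ∷ (map (shiftAt k) (take k p) ++ (0 ∷ map (shiftAt k) (drop k p)))

-- all children: k = 0,…,2m  (paper: x = 2,…,2m+2)
children : List ℕ → List (List ℕ)
children p = map (child p) (upTo (suc (length p)))

-- 𝒯(M,l) as a list (its elements are pairwise distinct)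
𝒯 : List ℕ → ℕ → List (List ℕ)
𝒯 p zero    = p ∷ []
𝒯 p (suc l) = concatMap children (𝒯 p l)

-- M_n = {{1,2n},{2,2n-1},…,{n,n+1}} : partner of i is 2n-1-i
Mₙ : ℕ → List ℕ
Mₙ n = map (λ i → 2 * n ∸ suc i) (upTo (2 * n))

Nₙ : ℕ → List ℕ
Nₙ n = concatMap (λ j → suc (2 * j) ∷ 2 * j ∷ []) (upTo n)

-- The child with new edge {0, k+1} gains, as new crossings, exactly the edges of its parent passing
-- over the gap before vertex k, and as new nestings exactly the edges ending before that gap. Hence
-- cr(𝒯(M,l)) is cr M shifted by a multiset computed from the crossing profile of M (the number of
-- edges over each gap) by an explicit branching rule, and likewise ne(𝒯(N,l)) from the nesting
-- profile of N. Both rules telescope into the same combination of complete homogeneous multisets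
-- of the profile, so these multisets only depend on the profile up to permutation. The profiles
-- 0,1,…,n,…,1,0 of Mₙ and 0,0,1,1,…,n of Nₙ are permutations of each other, and cr Mₙ = ne Nₙ = 0.
--
-- Conversely, levels 0 and 1 give cr M = ne N and that the crossing profile of M is a permutation
-- of the nesting profile of N. The latter is nondecreasing and ends in n, so some gap of M is crossed
-- by n edges, which forces the first n vertices of M to open edges. Then M has the crossing profile
-- of Mₙ, so the nesting profile of N is the staircase, which makes N alternate between openers and
-- closers: N = Nₙ. Finally cr M = ne Nₙ = 0, and the only noncrossing matching opening all of its
-- edges at the first n vertices is Mₙ.

module Submission where

open import Defs
open import Data.Nat using (ℕ)
open import Data.List using (List; map)
open import Data.Product using (_×_)
open import Function.Bundles using (_⇔_)
open import Relation.Binary.PropositionalEquality using (_≡_)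
open import Data.List.Relation.Binary.Permutation.Propositional using (_↭_)

open import Level using (Level)
open import Data.Nat using (zero; suc; _+_; _*_; _∸_; _<_; _≤_; _<ᵇ_; _<?_; _≟_; z≤n; s≤s)
open import Data.Nat.Properties
  using (≤-refl; ≤-trans; ≤-reflexive; ≤-antisym; ≤-pred; <⇒≤; <-trans; <-irrefl; <-cmp; n≤1+n; n<1+n; m≤m+n;
         m≤n⇒m≤1+n; m≤n⇒m<n∨m≡n; ≤∧≢⇒<; m≤n⇒m⊓n≡m; n≤0⇒n≡0; suc-injective; ≤-totalOrder;
         +-comm; +-assoc; +-suc; +-identityʳ; +-cancelˡ-≡; +-cancelʳ-≡; +-cancelˡ-≤; +-monoˡ-≤; m+n≡0⇒m≡0; m+n≡0⇒n≡0;
         m∸n≤m; m+n∸m≡n; m+n∸n≡m; m+[n∸m]≡n; m∸[m∸n]≡n; *-suc; *-monoʳ-≤; *-cancelˡ-≤; *-cancelˡ-≡; +-commutativeSemigroup;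
         module ≤-Reasoning)
open import Algebra.Properties.CommutativeSemigroup +-commutativeSemigroup using () renaming (interchange to +-interchange)
open import Data.Nat.Induction using (<-rec)
open import Data.Nat.ListAction using (sum)
open import Data.Bool using (Bool; true; false; if_then_else_; _∧_)
open import Data.Bool.Properties using (∧-zeroʳ; ∧-identityʳ; ∧-assoc; ∧-idem)
open import Data.List using ([]; _∷_; _++_; [_]; concatMap; upTo; applyUpTo; downFrom; take; drop; length; filter)
open import Data.List.Properties as List
  using (map-++; map-∘; map-cong; map-cong-local; map-id; map-upTo; map-applyUpTo; map-applyDownFrom; map-concatMap;
         concatMap-++; concatMap-map; concatMap-cong; concatMap-pure; ++-identityʳ; ∷-injectiveˡ; upTo-∷ʳ; downFrom-∷ʳ;
         length-map; length-upTo; length-downFrom; length-take; length-++-sucʳ; take++drop≡id; take-all; drop-all)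
open import Data.List.Relation.Unary.Any using (here; there)
open import Data.List.Relation.Unary.All using (All)
import Data.List.Relation.Unary.All as All
open import Data.List.Relation.Unary.All.Properties using (all-upTo; applyDownFrom⁺₁)
open import Data.List.Relation.Unary.Linked using (Linked; []; [-]; _∷_)
open import Data.List.Membership.Propositional using (_∈_)
open import Data.List.Membership.Propositional.Properties using (∈-map⁺; ∈-map⁻; ∈-upTo⁺; ∈-upTo⁻; ∈-filter⁺; ∈-++⁺ˡ)
open import Data.List.Relation.Binary.Pointwise using (Pointwise-≡⇒≡)
open import Data.List.Relation.Binary.Permutation.Propositional
open import Data.List.Relation.Binary.Permutation.Propositional.Properties
  using (++⁺; ++⁺ˡ; ++⁺ʳ; ++-comm; shifts; map⁺; ∈-resp-↭; ↭-singleton-inv)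
import Data.List.Relation.Unary.Sorted.TotalOrder.Properties as Sorted
open import Data.Product using (_,_; proj₁; proj₂; map₂; ∃-syntax)
open import Data.Sum using (_⊎_; inj₁; inj₂)
open import Data.Empty using (⊥-elim)
open import Function.Bundles using (mk⇔)
open import Relation.Nullary using (does; yes; no)
open import Relation.Nullary.Decidable using (dec-true; dec-false)
open import Relation.Unary using (Pred; Decidable)
open import Relation.Binary.Definitions using (tri<; tri≈; tri>)
open import Relation.Binary.PropositionalEquality as ≡ using (_≢_; refl; cong; cong₂)

-- Multisets of naturals

++-interchange : {A : Set} (a b c d : List A) → (a ++ b) ++ (c ++ d) ↭ (a ++ c) ++ (b ++ d)
++-interchange a b c d = begin
  (a ++ b) ++ (c ++ d) ≡⟨ List.++-assoc a b (c ++ d) ⟩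
  a ++ (b ++ (c ++ d)) ↭⟨ ++⁺ˡ a (shifts b c) ⟩
  a ++ (c ++ (b ++ d)) ≡⟨ List.++-assoc a c (b ++ d) ⟨
  (a ++ c) ++ (b ++ d) ∎
  where open PermutationReasoning

module _ {A B : Set} where

  concatMap-cong-↭ : {f g : A → List B} → (∀ x → f x ↭ g x) → ∀ xs → concatMap f xs ↭ concatMap g xs
  concatMap-cong-↭ f↭g []       = ↭-refl
  concatMap-cong-↭ f↭g (x ∷ xs) = ++⁺ (f↭g x) (concatMap-cong-↭ f↭g xs)

  concatMap-cong-↭-∈ : {f g : A → List B} → ∀ xs → (∀ x → x ∈ xs → f x ↭ g x) → concatMap f xs ↭ concatMap g xs
  concatMap-cong-↭-∈ []       f↭g = ↭-refl
  concatMap-cong-↭-∈ (x ∷ xs) f↭g = ++⁺ (f↭g x (here refl)) (concatMap-cong-↭-∈ xs (λ y y∈xs → f↭g y (there y∈xs)))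

  concatMap⁺ : (f : A → List B) {xs ys : List A} → xs ↭ ys → concatMap f xs ↭ concatMap f ys
  concatMap⁺ f refl         = ↭-refl
  concatMap⁺ f (prep x p)   = ++⁺ˡ (f x) (concatMap⁺ f p)
  concatMap⁺ f (swap {xs} {ys} x y p) = begin
    f x ++ f y ++ concatMap f xs ↭⟨ shifts (f x) (f y) ⟩
    f y ++ f x ++ concatMap f xs ↭⟨ ++⁺ˡ (f y) (++⁺ˡ (f x) (concatMap⁺ f p)) ⟩
    f y ++ f x ++ concatMap f ys ∎
    where open PermutationReasoning
  concatMap⁺ f (trans p q)  = ↭-trans (concatMap⁺ f p) (concatMap⁺ f q)

  concatMap-nil : ∀ xs → concatMap (λ (_ : A) → [] {A = B}) xs ≡ []
  concatMap-nil []       = refl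
  concatMap-nil (x ∷ xs) = concatMap-nil xs

  concatMap-++-distrib : (f g : A → List B) → ∀ xs →
    concatMap (λ x → f x ++ g x) xs ↭ concatMap f xs ++ concatMap g xs
  concatMap-++-distrib f g []       = ↭-refl
  concatMap-++-distrib f g (x ∷ xs) =
    ↭-trans (++⁺ˡ (f x ++ g x) (concatMap-++-distrib f g xs)) (++-interchange (f x) (g x) _ _)

module _ {A B C : Set} where

  concatMap-comm : (f : A → B → List C) → ∀ xs ys →
    concatMap (λ a → concatMap (f a) ys) xs ↭ concatMap (λ b → concatMap (λ a → f a b) xs) ys
  concatMap-comm f []       ys = ↭-reflexive (≡.sym (concatMap-nil ys))
  concatMap-comm f (x ∷ xs) ys = ↭-trans (++⁺ˡ _ (concatMap-comm f xs ys))
    (↭-sym (concatMap-++-distrib (f x) (λ b → concatMap (λ a → f a b) xs) ys))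

  concatMap-concatMap : (f : B → List C) (g : A → List B) → ∀ xs →
    concatMap f (concatMap g xs) ≡ concatMap (λ x → concatMap f (g x)) xs
  concatMap-concatMap f g []       = refl
  concatMap-concatMap f g (x ∷ xs) =
    ≡.trans (concatMap-++ f (g x) (concatMap g xs)) (cong (concatMap f (g x) ++_) (concatMap-concatMap f g xs))

infixr 6 _⊕_
infixr 7 _⊞_

_⊕_ : ℕ → List ℕ → List ℕ
w ⊕ xs = map (w +_) xs

_⊞_ : List ℕ → List ℕ → List ℕ
c ⊞ d = concatMap (_⊕ d) c

⊕-++ : ∀ w xs ys → w ⊕ (xs ++ ys) ≡ w ⊕ xs ++ w ⊕ ys
⊕-++ w = map-++ (w +_)

⊕-concatMap : {A : Set} (w : ℕ) (f : A → List ℕ) → ∀ xs → w ⊕ concatMap f xs ≡ concatMap (λ x → w ⊕ f x) xs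
⊕-concatMap w = map-concatMap (w +_)

⊕-⊕ : ∀ v w xs → v ⊕ w ⊕ xs ≡ (v + w) ⊕ xs
⊕-⊕ v w xs = ≡.trans (≡.sym (map-∘ xs)) (map-cong (λ x → ≡.sym (+-assoc v w x)) xs)

⊕-comm : ∀ v w xs → v ⊕ w ⊕ xs ≡ w ⊕ v ⊕ xs
⊕-comm v w xs = ≡.trans (⊕-⊕ v w xs) (≡.trans (cong (_⊕ xs) (+-comm v w)) (≡.sym (⊕-⊕ w v xs)))

⊕-identityˡ : ∀ xs → 0 ⊕ xs ≡ xs
⊕-identityˡ = map-id

⊕⁺ : ∀ w {xs ys} → xs ↭ ys → w ⊕ xs ↭ w ⊕ ys
⊕⁺ w = map⁺ (w +_)

⊕-interchange : ∀ w y a b c d → w ⊕ (y ⊕ a ++ b) ++ (y ⊕ c ++ d) ↭ y ⊕ (w ⊕ a ++ c) ++ (w ⊕ b ++ d)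
⊕-interchange w y a b c d = begin
  w ⊕ (y ⊕ a ++ b) ++ (y ⊕ c ++ d)        ≡⟨ cong (_++ (y ⊕ c ++ d)) (⊕-++ w (y ⊕ a) b) ⟩
  (w ⊕ y ⊕ a ++ w ⊕ b) ++ (y ⊕ c ++ d)    ↭⟨ ++-interchange (w ⊕ y ⊕ a) (w ⊕ b) (y ⊕ c) d ⟩
  (w ⊕ y ⊕ a ++ y ⊕ c) ++ (w ⊕ b ++ d)    ≡⟨ cong (λ u → (u ++ y ⊕ c) ++ (w ⊕ b ++ d)) (⊕-comm w y a) ⟩
  (y ⊕ w ⊕ a ++ y ⊕ c) ++ (w ⊕ b ++ d)    ≡⟨ cong (_++ (w ⊕ b ++ d)) (⊕-++ y (w ⊕ a) c) ⟨
  y ⊕ (w ⊕ a ++ c) ++ (w ⊕ b ++ d)        ∎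
  where open PermutationReasoning

⊞-distribʳ-++ : ∀ c c' d → (c ++ c') ⊞ d ≡ c ⊞ d ++ c' ⊞ d
⊞-distribʳ-++ c c' d = concatMap-++ (_⊕ d) c c'

⊞-distribˡ-++ : ∀ c d d' → c ⊞ (d ++ d') ↭ c ⊞ d ++ c ⊞ d'
⊞-distribˡ-++ c d d' = ↭-trans (concatMap-cong-↭ (λ a → ↭-reflexive (⊕-++ a d d')) c)
                                (concatMap-++-distrib (_⊕ d) (_⊕ d') c)

⊕-⊞ : ∀ w c d → w ⊕ c ⊞ d ≡ c ⊞ (w ⊕ d)
⊕-⊞ w c d = ≡.trans (⊕-concatMap w (_⊕ d) c) (concatMap-cong (λ a → ⊕-comm w a d) c)

⊞⁺ˡ : ∀ {c c'} d → c ↭ c' → c ⊞ d ↭ c' ⊞ d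
⊞⁺ˡ d = concatMap⁺ (_⊕ d)

⊞⁺ʳ : ∀ c {d d'} → d ↭ d' → c ⊞ d ↭ c ⊞ d'
⊞⁺ʳ c d↭d' = concatMap-cong-↭ (λ a → ⊕⁺ a d↭d') c

⊕-as-concatMap : ∀ a d → a ⊕ d ≡ concatMap (λ b → [ a + b ]) d
⊕-as-concatMap a d = ≡.trans (≡.sym (concatMap-pure (a ⊕ d))) (concatMap-map [_] (a +_) d)

⊞-comm : ∀ c d → c ⊞ d ↭ d ⊞ c
⊞-comm c d = begin
  c ⊞ d                                              ≡⟨ concatMap-cong (λ a → ⊕-as-concatMap a d) c ⟩
  concatMap (λ a → concatMap (λ b → [ a + b ]) d) c ↭⟨ concatMap-comm (λ a b → [ a + b ]) c d ⟩
  concatMap (λ b → concatMap (λ a → [ a + b ]) c) d ≡⟨ concatMap-cong (λ b → ≡.trans inner (≡.sym (⊕-as-concatMap b c))) d ⟩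
  d ⊞ c                                              ∎
  where
  open PermutationReasoning
  inner : ∀ {b} → concatMap (λ a → [ a + b ]) c ≡ concatMap (λ a → [ b + a ]) c
  inner {b} = concatMap-cong (λ a → cong [_] (+-comm a b)) c

⊞-assoc : ∀ c d e → (c ⊞ d) ⊞ e ≡ c ⊞ (d ⊞ e)
⊞-assoc c d e = ≡.trans (concatMap-concatMap (_⊕ e) (_⊕ d) c) (concatMap-cong shifted c)
  where
  shifted : ∀ a → concatMap (_⊕ e) (a ⊕ d) ≡ a ⊕ d ⊞ e
  shifted a = ≡.trans (concatMap-map (_⊕ e) (a +_) d)
             (≡.trans (concatMap-cong (λ b → ≡.sym (⊕-⊕ a b e)) d) (≡.sym (⊕-concatMap a (_⊕ e) d)))

⊞-concatMap : {A : Set} (c : List ℕ) (f : A → List ℕ) → ∀ xs → c ⊞ concatMap f xs ↭ concatMap (λ x → c ⊞ f x) xs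
⊞-concatMap c f []       = ↭-reflexive (concatMap-nil c)
⊞-concatMap c f (x ∷ xs) = ↭-trans (⊞-distribˡ-++ c (f x) _) (++⁺ˡ _ (⊞-concatMap c f xs))

⊞-identityˡ : ∀ d → [ 0 ] ⊞ d ≡ d
⊞-identityˡ d = ≡.trans (++-identityʳ (0 ⊕ d)) (⊕-identityˡ d)

⊞-zeroʳ : ∀ c → c ⊞ [] ≡ []
⊞-zeroʳ = concatMap-nil

-- Complete homogeneous multisets and branching rules

-- The multiset of sums of r-element multisubsets of h (the exponents of the complete homogeneous
-- polynomial h_r(q^h₁, q^h₂, …)).
complete : ℕ → List ℕ → List ℕ
complete zero    h       = [ 0 ]
complete (suc r) []      = []
complete (suc r) (x ∷ h) = x ⊕ complete r (x ∷ h) ++ complete (suc r) h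

complete-map-suc : ∀ s h → complete s (map suc h) ≡ s ⊕ complete s h
complete-map-suc zero    h       = refl
complete-map-suc (suc r) []      = refl
complete-map-suc (suc r) (x ∷ h) = begin
  suc x ⊕ complete r (suc x ∷ map suc h) ++ complete (suc r) (map suc h)
    ≡⟨ cong₂ (λ u v → suc x ⊕ u ++ v) (complete-map-suc r (x ∷ h)) (complete-map-suc (suc r) h) ⟩
  suc x ⊕ r ⊕ complete r (x ∷ h) ++ suc r ⊕ complete (suc r) h
    ≡⟨ cong (_++ suc r ⊕ complete (suc r) h) shuffle ⟩
  suc r ⊕ x ⊕ complete r (x ∷ h) ++ suc r ⊕ complete (suc r) h
    ≡⟨ ⊕-++ (suc r) (x ⊕ complete r (x ∷ h)) (complete (suc r) h) ⟨
  suc r ⊕ complete (suc r) (x ∷ h) ∎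
  where
  open ≡.≡-Reasoning
  shuffle : suc x ⊕ r ⊕ complete r (x ∷ h) ≡ suc r ⊕ x ⊕ complete r (x ∷ h)
  shuffle = ≡.trans (⊕-⊕ (suc x) r _) (≡.trans (cong (λ v → suc v ⊕ complete r (x ∷ h)) (+-comm x r)) (≡.sym (⊕-⊕ (suc r) x _)))

complete-0∷ : ∀ r h → complete r (0 ∷ h) ↭ concatMap (λ s → complete s h) (upTo (suc r))
complete-0∷ zero    h = ↭-refl
complete-0∷ (suc r) h = begin
  0 ⊕ complete r (0 ∷ h) ++ complete (suc r) h      ≡⟨ cong (_++ complete (suc r) h) (⊕-identityˡ _) ⟩
  complete r (0 ∷ h) ++ complete (suc r) h           ↭⟨ ++⁺ʳ _ (complete-0∷ r h) ⟩
  concatMap C (upTo (suc r)) ++ complete (suc r) h   ≡⟨ cong (concatMap C (upTo (suc r)) ++_) (++-identityʳ _) ⟨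
  concatMap C (upTo (suc r)) ++ concatMap C [ suc r ] ≡⟨ concatMap-++ C (upTo (suc r)) [ suc r ] ⟨
  concatMap C (upTo (suc r) ++ [ suc r ])            ≡⟨ cong (concatMap C) (upTo-∷ʳ (suc r)) ⟩
  concatMap C (upTo (suc (suc r)))                   ∎
  where
  open PermutationReasoning
  C = λ s → complete s h

complete-∷⁺ : ∀ x {h h'} → (∀ r → complete r h ↭ complete r h') → ∀ r → complete r (x ∷ h) ↭ complete r (x ∷ h')
complete-∷⁺ x h≈h' zero    = ↭-refl
complete-∷⁺ x h≈h' (suc r) = ++⁺ (⊕⁺ x (complete-∷⁺ x h≈h' r)) (h≈h' (suc r))

complete-swap : ∀ x y h r → complete r (x ∷ y ∷ h) ↭ complete r (y ∷ x ∷ h)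
complete-swap x y h zero          = ↭-refl
complete-swap x y h (suc zero)    = swap (x + 0) (y + 0) ↭-refl
complete-swap x y h (suc (suc r)) = begin
  x ⊕ complete (suc r) (x ∷ y ∷ h) ++ (y ⊕ C ++ R)           ↭⟨ ++⁺ʳ _ (⊕⁺ x (complete-swap x y h (suc r))) ⟩
  x ⊕ (y ⊕ complete r (y ∷ x ∷ h) ++ B) ++ (y ⊕ C ++ R)     ↭⟨ ⊕-interchange x y (complete r (y ∷ x ∷ h)) B C R ⟩
  y ⊕ (x ⊕ complete r (y ∷ x ∷ h) ++ C) ++ (x ⊕ B ++ R)     ↭⟨ ++⁺ʳ _ (⊕⁺ y (++⁺ʳ C (⊕⁺ x (complete-swap y x h r)))) ⟩
  y ⊕ complete (suc r) (x ∷ y ∷ h) ++ (x ⊕ B ++ R)           ↭⟨ ++⁺ʳ _ (⊕⁺ y (complete-swap x y h (suc r))) ⟩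
  y ⊕ complete (suc r) (y ∷ x ∷ h) ++ (x ⊕ B ++ R)           ∎
  where
  open PermutationReasoning
  B = complete (suc r) (x ∷ h)
  C = complete (suc r) (y ∷ h)
  R = complete (suc (suc r)) h

complete-↭ : ∀ {h h'} → h ↭ h' → ∀ r → complete r h ↭ complete r h'
complete-↭ refl         r = ↭-refl
complete-↭ (prep x p)   r = complete-∷⁺ x (complete-↭ p) r
complete-↭ (swap x y p) r = ↭-trans (complete-swap x y _ r) (complete-∷⁺ y (complete-∷⁺ x (complete-↭ p)) r)
complete-↭ (trans p q)  r = ↭-trans (complete-↭ p r) (complete-↭ q r)

-- For a profile h, one pair per child: the increase of the statistic and the child's profile
-- without its leading 0.
Branching : Set
Branching = List ℕ → List (ℕ × List ℕ)

weighted : (List ℕ → List ℕ) → ℕ × List ℕ → List ℕ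
weighted f (w , t) = w ⊕ f t

pathWeights : Branching → ℕ → List ℕ → List ℕ
pathWeights br zero    h = [ 0 ]
pathWeights br (suc l) h = concatMap (weighted (λ t → pathWeights br l (0 ∷ t))) (br h)

Telescoping : Branching → Set
Telescoping br = ∀ h s → concatMap (weighted (complete s)) (br h) ↭ upTo (suc s) ⊞ complete (suc s) h

weighted-complete₀-map₂ : ∀ f K → concatMap (weighted (complete 0)) (map (map₂ f) K) ≡ concatMap (weighted (complete 0)) K
weighted-complete₀-map₂ f []      = refl
weighted-complete₀-map₂ f (p ∷ K) = cong (proj₁ p ⊕ [ 0 ] ++_) (weighted-complete₀-map₂ f K)

weighted-complete-suc-map₂ : ∀ s y K →
  concatMap (weighted (complete (suc s))) (map (map₂ (y ∷_)) K)
    ↭ y ⊕ concatMap (weighted (complete s)) (map (map₂ (y ∷_)) K) ++ concatMap (weighted (complete (suc s))) K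
weighted-complete-suc-map₂ s y []            = ↭-refl
weighted-complete-suc-map₂ s y ((w , t) ∷ K) =
  ↭-trans (++⁺ˡ (w ⊕ complete (suc s) (y ∷ t)) (weighted-complete-suc-map₂ s y K))
          (⊕-interchange w y (complete s (y ∷ t)) (complete (suc s) t) _ _)

upTo-suc-⊞-⊕ : ∀ n x Z → upTo (suc n) ⊞ (x ⊕ Z) ≡ x ⊕ Z ++ suc x ⊕ upTo n ⊞ Z
upTo-suc-⊞-⊕ n x Z = cong₂ _++_ (⊕-identityˡ (x ⊕ Z)) (begin
  concatMap (_⊕ (x ⊕ Z)) (applyUpTo suc n)       ≡⟨ cong (concatMap (_⊕ (x ⊕ Z))) (map-upTo suc n) ⟨
  concatMap (_⊕ (x ⊕ Z)) (map suc (upTo n))      ≡⟨ concatMap-map (_⊕ (x ⊕ Z)) suc (upTo n) ⟩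
  concatMap (λ a → suc a ⊕ x ⊕ Z) (upTo n)     ≡⟨ concatMap-cong reassociate (upTo n) ⟩
  concatMap (λ a → suc x ⊕ a ⊕ Z) (upTo n)     ≡⟨ ⊕-concatMap (suc x) (_⊕ Z) (upTo n) ⟨
  suc x ⊕ upTo n ⊞ Z                            ∎)
  where
  open ≡.≡-Reasoning
  reassociate : ∀ a → suc a ⊕ x ⊕ Z ≡ suc x ⊕ a ⊕ Z
  reassociate a = ≡.trans (⊕-⊕ (suc a) x Z) (≡.trans (cong (λ v → suc v ⊕ Z) (+-comm a x)) (≡.sym (⊕-⊕ (suc x) a Z)))

upTo-suc-⊞ : ∀ n W → upTo (suc n) ⊞ W ≡ upTo n ⊞ W ++ n ⊕ W
upTo-suc-⊞ n W = begin
  upTo (suc n) ⊞ W          ≡⟨ cong (_⊞ W) (upTo-∷ʳ n) ⟨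
  (upTo n ++ [ n ]) ⊞ W     ≡⟨ ⊞-distribʳ-++ (upTo n) [ n ] W ⟩
  upTo n ⊞ W ++ [ n ] ⊞ W   ≡⟨ cong (upTo n ⊞ W ++_) (++-identityʳ (n ⊕ W)) ⟩
  upTo n ⊞ W ++ n ⊕ W       ∎
  where open ≡.≡-Reasoning

crossBranching : Branching
crossBranching []      = []
crossBranching (x ∷ h) = map (map₂ (suc x ∷_)) ((x , x ∷ h) ∷ crossBranching h)

nestBranching : Branching
nestBranching []      = []
nestBranching (x ∷ h) = map (map₂ (x ∷_)) ((x , suc x ∷ map suc h) ∷ nestBranching h)

telescoping-zero-step : ∀ f x T K h →
  concatMap (weighted (complete 0)) K ↭ [ 0 ] ⊞ complete 1 h →
  concatMap (weighted (complete 0)) (map (map₂ f) ((x , T) ∷ K)) ↭ [ 0 ] ⊞ complete 1 (x ∷ h)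
telescoping-zero-step f x T K h tel = begin
  concatMap (weighted (complete 0)) (map (map₂ f) ((x , T) ∷ K)) ≡⟨ weighted-complete₀-map₂ f ((x , T) ∷ K) ⟩
  x ⊕ [ 0 ] ++ concatMap (weighted (complete 0)) K              ↭⟨ ++⁺ˡ (x ⊕ [ 0 ]) tel ⟩
  x ⊕ [ 0 ] ++ [ 0 ] ⊞ complete 1 h                             ≡⟨ cong (x ⊕ [ 0 ] ++_) (⊞-identityˡ (complete 1 h)) ⟩
  complete 1 (x ∷ h)                                             ≡⟨ ⊞-identityˡ (complete 1 (x ∷ h)) ⟨
  [ 0 ] ⊞ complete 1 (x ∷ h)                                     ∎
  where open PermutationReasoning

crossBranching-telescoping : Telescoping crossBranching
crossBranching-telescoping []      s       = ↭-reflexive (≡.sym (⊞-zeroʳ (upTo (suc s))))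
crossBranching-telescoping (x ∷ h) zero    =
  telescoping-zero-step (suc x ∷_) x (x ∷ h) (crossBranching h) h (crossBranching-telescoping h 0)
crossBranching-telescoping (x ∷ h) (suc s) = begin
  concatMap (weighted (complete (suc s))) (crossBranching (x ∷ h))
    ↭⟨ weighted-complete-suc-map₂ s (suc x) ((x , x ∷ h) ∷ crossBranching h) ⟩
  suc x ⊕ A s (crossBranching (x ∷ h)) ++ (x ⊕ Z ++ A (suc s) (crossBranching h))
    ↭⟨ ++⁺ (⊕⁺ (suc x) (crossBranching-telescoping (x ∷ h) s)) (++⁺ˡ (x ⊕ Z) (crossBranching-telescoping h (suc s))) ⟩
  suc x ⊕ upTo (suc s) ⊞ Z ++ (x ⊕ Z ++ R)
    ↭⟨ shifts (suc x ⊕ upTo (suc s) ⊞ Z) (x ⊕ Z) ⟩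
  x ⊕ Z ++ (suc x ⊕ upTo (suc s) ⊞ Z ++ R)
    ≡⟨ List.++-assoc (x ⊕ Z) (suc x ⊕ upTo (suc s) ⊞ Z) R ⟨
  (x ⊕ Z ++ suc x ⊕ upTo (suc s) ⊞ Z) ++ R
    ≡⟨ cong (_++ R) (upTo-suc-⊞-⊕ (suc s) x Z) ⟨
  upTo (suc (suc s)) ⊞ (x ⊕ Z) ++ R
    ↭⟨ ⊞-distribˡ-++ (upTo (suc (suc s))) (x ⊕ Z) (complete (suc (suc s)) h) ⟨
  upTo (suc (suc s)) ⊞ complete (suc (suc s)) (x ∷ h) ∎
  where
  open PermutationReasoning
  A = λ r → concatMap (weighted (complete r))
  Z = complete (suc s) (x ∷ h)
  R = upTo (suc (suc s)) ⊞ complete (suc (suc s)) h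

nestBranching-telescoping : Telescoping nestBranching
nestBranching-telescoping []      s       = ↭-reflexive (≡.sym (⊞-zeroʳ (upTo (suc s))))
nestBranching-telescoping (x ∷ h) zero    =
  telescoping-zero-step (x ∷_) x (suc x ∷ map suc h) (nestBranching h) h (nestBranching-telescoping h 0)
nestBranching-telescoping (x ∷ h) (suc s) = begin
  concatMap (weighted (complete (suc s))) (nestBranching (x ∷ h))
    ↭⟨ weighted-complete-suc-map₂ s x ((x , suc x ∷ map suc h) ∷ nestBranching h) ⟩
  x ⊕ A s (nestBranching (x ∷ h)) ++ (x ⊕ complete (suc s) (map suc (x ∷ h)) ++ A (suc s) (nestBranching h))
    ↭⟨ ++⁺ (⊕⁺ x (nestBranching-telescoping (x ∷ h) s)) (++⁺ˡ _ (nestBranching-telescoping h (suc s))) ⟩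
  x ⊕ upTo (suc s) ⊞ Z ++ (x ⊕ complete (suc s) (map suc (x ∷ h)) ++ R)
    ≡⟨ cong (λ u → x ⊕ upTo (suc s) ⊞ Z ++ (x ⊕ u ++ R)) (complete-map-suc (suc s) (x ∷ h)) ⟩
  x ⊕ upTo (suc s) ⊞ Z ++ (x ⊕ suc s ⊕ Z ++ R)
    ≡⟨ List.++-assoc (x ⊕ upTo (suc s) ⊞ Z) (x ⊕ suc s ⊕ Z) R ⟨
  (x ⊕ upTo (suc s) ⊞ Z ++ x ⊕ suc s ⊕ Z) ++ R
    ≡⟨ cong (_++ R) (cong₂ _++_ (⊕-⊞ x (upTo (suc s)) Z) (⊕-comm x (suc s) Z)) ⟩
  (upTo (suc s) ⊞ (x ⊕ Z) ++ suc s ⊕ x ⊕ Z) ++ R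
    ≡⟨ cong (_++ R) (upTo-suc-⊞ (suc s) (x ⊕ Z)) ⟨
  upTo (suc (suc s)) ⊞ (x ⊕ Z) ++ R
    ↭⟨ ⊞-distribˡ-++ (upTo (suc (suc s))) (x ⊕ Z) (complete (suc (suc s)) h) ⟨
  upTo (suc (suc s)) ⊞ complete (suc (suc s)) (x ∷ h) ∎
  where
  open PermutationReasoning
  A = λ r → concatMap (weighted (complete r))
  Z = complete (suc s) (x ∷ h)
  R = upTo (suc (suc s)) ⊞ complete (suc (suc s)) h

NormalForm : Set
NormalForm = List (List ℕ × ℕ)

evalTerm : List ℕ → List ℕ × ℕ → List ℕ
evalTerm h (c , r) = c ⊞ complete r h

evalNF : NormalForm → List ℕ → List ℕ
evalNF cs h = concatMap (evalTerm h) cs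

expand : List ℕ × ℕ → NormalForm
expand (c , r) = map (λ s → (upTo (suc s) ⊞ c , suc s)) (upTo (suc r))

levelNF : ℕ → NormalForm
levelNF zero    = [ ([ 0 ] , 0) ]
levelNF (suc l) = concatMap expand (levelNF l)

module _ {br : Branching} (tel : Telescoping br) where

  branch-complete-0∷ : ∀ h r → concatMap (weighted (λ t → complete r (0 ∷ t))) (br h)
                               ↭ concatMap (λ s → upTo (suc s) ⊞ complete (suc s) h) (upTo (suc r))
  branch-complete-0∷ h r = begin
    concatMap (weighted (λ t → complete r (0 ∷ t))) (br h)
      ↭⟨ concatMap-cong-↭ (λ p → ⊕⁺ (proj₁ p) (complete-0∷ r (proj₂ p))) (br h) ⟩
    concatMap (λ p → proj₁ p ⊕ concatMap (λ s → complete s (proj₂ p)) U) (br h)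
      ≡⟨ concatMap-cong (λ p → ⊕-concatMap (proj₁ p) (λ s → complete s (proj₂ p)) U) (br h) ⟩
    concatMap (λ p → concatMap (λ s → weighted (complete s) p) U) (br h)
      ↭⟨ concatMap-comm (λ p s → weighted (complete s) p) (br h) U ⟩
    concatMap (λ s → concatMap (weighted (complete s)) (br h)) U
      ↭⟨ concatMap-cong-↭ (tel h) U ⟩
    concatMap (λ s → upTo (suc s) ⊞ complete (suc s) h) U ∎
    where
    open PermutationReasoning
    U = upTo (suc r)

  branch-evalTerm : ∀ h c r → concatMap (weighted (λ t → evalTerm (0 ∷ t) (c , r))) (br h)
                              ↭ evalNF (expand (c , r)) h
  branch-evalTerm h c r = begin
    concatMap (weighted (λ t → c ⊞ complete r (0 ∷ t))) (br h)
      ≡⟨ concatMap-cong (λ p → ⊕-⊞ (proj₁ p) c (complete r (0 ∷ proj₂ p))) (br h) ⟩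
    concatMap (λ p → c ⊞ weighted (λ t → complete r (0 ∷ t)) p) (br h)
      ↭⟨ ⊞-concatMap c (weighted (λ t → complete r (0 ∷ t))) (br h) ⟨
    c ⊞ concatMap (weighted (λ t → complete r (0 ∷ t))) (br h)
      ↭⟨ ⊞⁺ʳ c (branch-complete-0∷ h r) ⟩
    c ⊞ concatMap (λ s → upTo (suc s) ⊞ complete (suc s) h) U
      ↭⟨ ⊞-concatMap c (λ s → upTo (suc s) ⊞ complete (suc s) h) U ⟩
    concatMap (λ s → c ⊞ upTo (suc s) ⊞ complete (suc s) h) U
      ↭⟨ concatMap-cong-↭ commute U ⟩
    concatMap (λ s → (upTo (suc s) ⊞ c) ⊞ complete (suc s) h) U
      ≡⟨ concatMap-map (evalTerm h) (λ s → (upTo (suc s) ⊞ c , suc s)) U ⟨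
    evalNF (expand (c , r)) h ∎
    where
    open PermutationReasoning
    U = upTo (suc r)
    commute : ∀ s → c ⊞ upTo (suc s) ⊞ complete (suc s) h ↭ (upTo (suc s) ⊞ c) ⊞ complete (suc s) h
    commute s = ↭-trans (↭-reflexive (≡.sym (⊞-assoc c (upTo (suc s)) _))) (⊞⁺ˡ _ (⊞-comm c (upTo (suc s))))

  pathWeights-normalForm : ∀ l h → pathWeights br l h ↭ evalNF (levelNF l) h
  pathWeights-normalForm zero    h = ↭-refl
  pathWeights-normalForm (suc l) h = begin
    concatMap (weighted (λ t → pathWeights br l (0 ∷ t))) (br h)
      ↭⟨ concatMap-cong-↭ (λ p → ⊕⁺ (proj₁ p) (pathWeights-normalForm l (0 ∷ proj₂ p))) (br h) ⟩
    concatMap (weighted (λ t → evalNF C (0 ∷ t))) (br h)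
      ≡⟨ concatMap-cong (λ p → ⊕-concatMap (proj₁ p) (evalTerm (0 ∷ proj₂ p)) C) (br h) ⟩
    concatMap (λ p → concatMap (λ cr → weighted (λ t → evalTerm (0 ∷ t) cr) p) C) (br h)
      ↭⟨ concatMap-comm (λ p cr → weighted (λ t → evalTerm (0 ∷ t) cr) p) (br h) C ⟩
    concatMap (λ cr → concatMap (weighted (λ t → evalTerm (0 ∷ t) cr)) (br h)) C
      ↭⟨ concatMap-cong-↭ (λ cr → branch-evalTerm h (proj₁ cr) (proj₂ cr)) C ⟩
    concatMap (λ cr → evalNF (expand cr) h) C
      ≡⟨ concatMap-concatMap (evalTerm h) expand C ⟨
    evalNF (levelNF (suc l)) h ∎
    where
    open PermutationReasoning
    C = levelNF l

evalNF-↭ : ∀ cs {h h'} → h ↭ h' → evalNF cs h ↭ evalNF cs h'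
evalNF-↭ cs h↭h' = concatMap-cong-↭ (λ cr → ⊞⁺ʳ (proj₁ cr) (complete-↭ h↭h' (proj₂ cr))) cs

pathWeights-↭ : ∀ {br br'} → Telescoping br → Telescoping br' →
  ∀ l {h h'} → h ↭ h' → pathWeights br l h ↭ pathWeights br' l h'
pathWeights-↭ tel tel' l {h} {h'} h↭h' = ↭-trans (pathWeights-normalForm tel l h)
  (↭-trans (evalNF-↭ (levelNF l) h↭h') (↭-sym (pathWeights-normalForm tel' l h')))

-- Edges of a child

<ᵇ-true : ∀ {m n} → m < n → (m <ᵇ n) ≡ true
<ᵇ-true {zero}  {suc n} _         = refl
<ᵇ-true {suc m} {suc n} (s≤s m<n) = <ᵇ-true m<n

<ᵇ-false : ∀ {m n} → n ≤ m → (m <ᵇ n) ≡ false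
<ᵇ-false {m}     {zero}  _         = refl
<ᵇ-false {suc m} {suc n} (s≤s n≤m) = <ᵇ-false n≤m

<ᵇ-true⁻ : ∀ {m n} → (m <ᵇ n) ≡ true → m < n
<ᵇ-true⁻ {zero}  {suc n} _ = s≤s z≤n
<ᵇ-true⁻ {suc m} {suc n} e = s≤s (<ᵇ-true⁻ e)

<ᵇ-false⁻ : ∀ {m n} → (m <ᵇ n) ≡ false → n ≤ m
<ᵇ-false⁻ {m}     {zero}  _ = z≤n
<ᵇ-false⁻ {suc m} {suc n} e = s≤s (<ᵇ-false⁻ e)

<ᵇ-cases : ∀ m n → m < n × (m <ᵇ n) ≡ true ⊎ n ≤ m × (m <ᵇ n) ≡ false
<ᵇ-cases m n with m <ᵇ n in eq
... | true  = inj₁ (<ᵇ-true⁻ eq , refl)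
... | false = inj₂ (<ᵇ-false⁻ eq , refl)

shiftAt-< : ∀ {k i} → i < k → shiftAt k i ≡ suc i
shiftAt-< i<k rewrite <ᵇ-true i<k = refl

shiftAt-≥ : ∀ {k i} → k ≤ i → shiftAt k i ≡ suc (suc i)
shiftAt-≥ k≤i rewrite <ᵇ-false k≤i = refl

shiftAt-cases : ∀ k x → x < k × shiftAt k x ≡ suc x ⊎ k ≤ x × shiftAt k x ≡ suc (suc x)
shiftAt-cases k x with <ᵇ-cases x k
... | inj₁ (x<k , _) = inj₁ (x<k , shiftAt-< x<k)
... | inj₂ (k≤x , _) = inj₂ (k≤x , shiftAt-≥ k≤x)

shiftAt-<ᵇ-shiftAt : ∀ k a b → (shiftAt k a <ᵇ shiftAt k b) ≡ (a <ᵇ b)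
shiftAt-<ᵇ-shiftAt k a b with shiftAt-cases k a | shiftAt-cases k b
... | inj₁ (a<k , ea) | inj₁ (b<k , eb) rewrite ea | eb = refl
... | inj₂ (k≤a , ea) | inj₂ (k≤b , eb) rewrite ea | eb = refl
... | inj₁ (a<k , ea) | inj₂ (k≤b , eb) rewrite ea | eb =
  ≡.trans (<ᵇ-true {suc a} (s≤s (m≤n⇒m≤1+n a<b))) (≡.sym (<ᵇ-true a<b))
  where a<b = ≤-trans a<k k≤b
... | inj₂ (k≤a , ea) | inj₁ (b<k , eb) rewrite ea | eb =
  ≡.trans (<ᵇ-false {suc (suc a)} {suc b} (s≤s (m≤n⇒m≤1+n (<⇒≤ b<a)))) (≡.sym (<ᵇ-false (<⇒≤ b<a)))
  where b<a = ≤-trans b<k k≤a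

0<ᵇshiftAt : ∀ k a → (0 <ᵇ shiftAt k a) ≡ true
0<ᵇshiftAt k a with shiftAt-cases k a
... | inj₁ (_ , e) rewrite e = refl
... | inj₂ (_ , e) rewrite e = refl

-- The gap just before old vertex j becomes the gap before new vertex j+1 when j ≤ k,
-- and the gap before new vertex j+2 when k ≤ j (for j = k, the new vertex k+1 sits between them).
shiftAt-<ᵇ-suc : ∀ {j k} x → j ≤ k → (shiftAt k x <ᵇ suc j) ≡ (x <ᵇ j)
shiftAt-<ᵇ-suc {j} {k} x j≤k with shiftAt-cases k x
... | inj₁ (_   , e) rewrite e = refl
... | inj₂ (k≤x , e) rewrite e = ≡.trans (<ᵇ-false (m≤n⇒m≤1+n j≤x)) (≡.sym (<ᵇ-false j≤x))
  where j≤x = ≤-trans j≤k k≤x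

<ᵇ-shiftAt : ∀ {j k} x → j ≤ k → (j <ᵇ shiftAt k x) ≡ (j <ᵇ suc x)
<ᵇ-shiftAt {j} {k} x j≤k with shiftAt-cases k x
... | inj₁ (_   , e) rewrite e = refl
... | inj₂ (k≤x , e) rewrite e = ≡.trans (<ᵇ-true (s≤s (m≤n⇒m≤1+n j≤x))) (≡.sym (<ᵇ-true (s≤s j≤x)))
  where j≤x = ≤-trans j≤k k≤x

shiftAt-<ᵇ-2+ : ∀ {j k} x → k ≤ j → (shiftAt k x <ᵇ suc (suc j)) ≡ (x <ᵇ j)
shiftAt-<ᵇ-2+ {j} {k} x k≤j with shiftAt-cases k x
... | inj₁ (x<k , e) rewrite e = ≡.trans (<ᵇ-true (m≤n⇒m≤1+n x<j)) (≡.sym (<ᵇ-true x<j))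
  where x<j = ≤-trans x<k k≤j
... | inj₂ (_   , e) rewrite e = refl

suc-<ᵇ-shiftAt : ∀ {j k} x → k ≤ j → (suc j <ᵇ shiftAt k x) ≡ (j <ᵇ suc x)
suc-<ᵇ-shiftAt {j} {k} x k≤j with shiftAt-cases k x
... | inj₁ (x<k , e) rewrite e = ≡.trans (<ᵇ-false (<⇒≤ x<j)) (≡.sym (<ᵇ-false x<j))
  where x<j = ≤-trans x<k k≤j
... | inj₂ (_   , e) rewrite e = refl

shiftEdge : ℕ → ℕ × ℕ → ℕ × ℕ
shiftEdge k (a , b) = (shiftAt k a , shiftAt k b)

-- Edges of a partner list whose i-th entry is the partner of vertex ℓ i.
edgesFrom : (ℕ → ℕ) → List ℕ → List (ℕ × ℕ)
edgesFrom ℓ []       = []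
edgesFrom ℓ (x ∷ xs) = if ℓ 0 <ᵇ x then (ℓ 0 , x) ∷ edgesFrom (λ i → ℓ (suc i)) xs else edgesFrom (λ i → ℓ (suc i)) xs

filter-map : {A B : Set} {p : Level} {P : Pred B p} (P? : Decidable P) (f : A → B) → ∀ xs →
  filter P? (map f xs) ≡ map f (filter (λ x → P? (f x)) xs)
filter-map P? f []       = refl
filter-map P? f (x ∷ xs) with does (P? (f x))
... | true  = cong (f x ∷_) (filter-map P? f xs)
... | false = filter-map P? f xs

edges-labelled : ∀ (ℓ : ℕ → ℕ) xs →
  map (λ i → (ℓ i , at xs i)) (filter (λ i → ℓ i <? at xs i) (upTo (length xs))) ≡ edgesFrom ℓ xs
edges-labelled-suc : ∀ (ℓ : ℕ → ℕ) x xs →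
  map (λ i → (ℓ i , at (x ∷ xs) i)) (filter (λ i → ℓ i <? at (x ∷ xs) i) (applyUpTo suc (length xs)))
    ≡ edgesFrom (λ i → ℓ (suc i)) xs

edges-labelled ℓ []       = refl
edges-labelled ℓ (x ∷ xs) with ℓ 0 <ᵇ x
... | true  = cong ((ℓ 0 , x) ∷_) (edges-labelled-suc ℓ x xs)
... | false = edges-labelled-suc ℓ x xs

edges-labelled-suc ℓ x xs = begin
  map e (filter P? (applyUpTo suc (length xs)))    ≡⟨ cong (λ is → map e (filter P? is)) (map-upTo suc (length xs)) ⟨
  map e (filter P? (map suc (upTo (length xs))))   ≡⟨ cong (map e) (filter-map P? suc (upTo (length xs))) ⟩
  map e (map suc (filter (λ i → P? (suc i)) (upTo (length xs))))
    ≡⟨ map-∘ (filter (λ i → P? (suc i)) (upTo (length xs))) ⟨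
  map (λ i → e (suc i)) (filter (λ i → P? (suc i)) (upTo (length xs)))
    ≡⟨ edges-labelled (λ i → ℓ (suc i)) xs ⟩
  edgesFrom (λ i → ℓ (suc i)) xs ∎
  where
  open ≡.≡-Reasoning
  e = λ i → (ℓ i , at (x ∷ xs) i)
  P? = λ i → ℓ i <? at (x ∷ xs) i

edges≡edgesFrom : ∀ p → edges p ≡ edgesFrom (λ i → i) p
edges≡edgesFrom = edges-labelled (λ i → i)

edgesFrom-cong : ∀ {ℓ ℓ' : ℕ → ℕ} xs → (∀ i → i < length xs → ℓ i ≡ ℓ' i) → edgesFrom ℓ xs ≡ edgesFrom ℓ' xs
edgesFrom-cong             []       eq = refl
edgesFrom-cong {ℓ} {ℓ'} (x ∷ xs) eq rewrite eq 0 (s≤s z≤n) with ℓ' 0 <ᵇ x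
... | true  = cong ((ℓ' 0 , x) ∷_) (edgesFrom-cong xs (λ i i<n → eq (suc i) (s≤s i<n)))
... | false = edgesFrom-cong xs (λ i i<n → eq (suc i) (s≤s i<n))

edgesFrom-++ : ∀ (ℓ : ℕ → ℕ) ys zs → edgesFrom ℓ (ys ++ zs) ≡ edgesFrom ℓ ys ++ edgesFrom (λ i → ℓ (length ys + i)) zs
edgesFrom-++ ℓ []       zs = refl
edgesFrom-++ ℓ (y ∷ ys) zs with ℓ 0 <ᵇ y
... | true  = cong ((ℓ 0 , y) ∷_) (edgesFrom-++ (λ i → ℓ (suc i)) ys zs)
... | false = edgesFrom-++ (λ i → ℓ (suc i)) ys zs

edgesFrom-shift : ∀ k (ℓ : ℕ → ℕ) ys →
  edgesFrom (λ i → shiftAt k (ℓ i)) (map (shiftAt k) ys) ≡ map (shiftEdge k) (edgesFrom ℓ ys)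
edgesFrom-shift k ℓ []       = refl
edgesFrom-shift k ℓ (y ∷ ys) rewrite shiftAt-<ᵇ-shiftAt k (ℓ 0) y with ℓ 0 <ᵇ y
... | true  = cong (shiftEdge k (ℓ 0 , y) ∷_) (edgesFrom-shift k (λ i → ℓ (suc i)) ys)
... | false = edgesFrom-shift k (λ i → ℓ (suc i)) ys

length-take-≤ : ∀ {A : Set} k (xs : List A) → k ≤ length xs → length (take k xs) ≡ k
length-take-≤ k xs k≤n = ≡.trans (length-take k xs) (m≤n⇒m⊓n≡m k≤n)

edgesFrom-take-drop : ∀ k p → k ≤ length p → edgesFrom (λ i → i) (take k p) ++ edgesFrom (k +_) (drop k p) ≡ edgesFrom (λ i → i) p
edgesFrom-take-drop k p k≤n = begin
  edgesFrom (λ i → i) (take k p) ++ edgesFrom (k +_) (drop k p)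
    ≡⟨ cong (λ m → edgesFrom (λ i → i) (take k p) ++ edgesFrom (m +_) (drop k p)) (length-take-≤ k p k≤n) ⟨
  edgesFrom (λ i → i) (take k p) ++ edgesFrom (length (take k p) +_) (drop k p)
    ≡⟨ edgesFrom-++ (λ i → i) (take k p) (drop k p) ⟨
  edgesFrom (λ i → i) (take k p ++ drop k p)
    ≡⟨ cong (edgesFrom (λ i → i)) (take++drop≡id k p) ⟩
  edgesFrom (λ i → i) p ∎
  where open ≡.≡-Reasoning

edges-child : ∀ p k → k ≤ length p → edges (child p k) ≡ (0 , suc k) ∷ map (shiftEdge k) (edges p)
edges-child p k k≤n = ≡.trans (edges≡edgesFrom (child p k)) (cong ((0 , suc k) ∷_) (begin
  edgesFrom suc (A ++ 0 ∷ B)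
    ≡⟨ edgesFrom-++ suc A (0 ∷ B) ⟩
  edgesFrom suc A ++ edgesFrom (λ i → suc (length A + suc i)) B
    ≡⟨ cong₂ _++_ (edgesFrom-cong A before) (edgesFrom-cong B (λ i _ → after i)) ⟩
  edgesFrom (shiftAt k) A ++ edgesFrom (λ i → shiftAt k (k + i)) B
    ≡⟨ cong₂ _++_ (edgesFrom-shift k (λ i → i) (take k p)) (edgesFrom-shift k (k +_) (drop k p)) ⟩
  map (shiftEdge k) (edgesFrom (λ i → i) (take k p)) ++ map (shiftEdge k) (edgesFrom (k +_) (drop k p))
    ≡⟨ map-++ (shiftEdge k) (edgesFrom (λ i → i) (take k p)) (edgesFrom (k +_) (drop k p)) ⟨
  map (shiftEdge k) (edgesFrom (λ i → i) (take k p) ++ edgesFrom (k +_) (drop k p))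
    ≡⟨ cong (map (shiftEdge k)) (≡.trans (edgesFrom-take-drop k p k≤n) (≡.sym (edges≡edgesFrom p))) ⟩
  map (shiftEdge k) (edges p) ∎))
  where
  open ≡.≡-Reasoning
  A = map (shiftAt k) (take k p)
  B = map (shiftAt k) (drop k p)
  |A| : length A ≡ k
  |A| = ≡.trans (length-map (shiftAt k) (take k p)) (length-take-≤ k p k≤n)
  before : ∀ i → i < length A → suc i ≡ shiftAt k i
  before i i<|A| = ≡.sym (shiftAt-< (≡.subst (i <_) |A| i<|A|))
  after : ∀ i → suc (length A + suc i) ≡ shiftAt k (k + i)
  after i = ≡.trans (cong (λ m → suc (m + suc i)) |A|) (≡.trans (cong suc (+-suc k i)) (≡.sym (shiftAt-≥ (m≤m+n k i))))

ind : Bool → ℕ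
ind b = if b then 1 else 0

count-map : ∀ {A B : Set} (g : B → Bool) (f : A → B) xs → count g (map f xs) ≡ count (λ x → g (f x)) xs
count-map g f []       = refl
count-map g f (x ∷ xs) = cong (ind (g (f x)) +_) (count-map g f xs)

count-cong : ∀ {A : Set} {g g' : A → Bool} → (∀ x → g x ≡ g' x) → ∀ xs → count g xs ≡ count g' xs
count-cong g≗g' []       = refl
count-cong g≗g' (x ∷ xs) = cong₂ (λ b n → ind b + n) (g≗g' x) (count-cong g≗g' xs)

relatedPairs : (ℕ × ℕ → ℕ × ℕ → Bool) → List (ℕ × ℕ) → ℕ
relatedPairs r E = sum (map (λ e → count (r e) E) E)

relatedPairs-∷-map : ∀ r (f : ℕ × ℕ → ℕ × ℕ) e₀ E →
  r e₀ e₀ ≡ false → (∀ e → r (f e) e₀ ≡ false) → (∀ e e' → r (f e) (f e') ≡ r e e') →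
  relatedPairs r (e₀ ∷ map f E) ≡ count (r e₀) (map f E) + relatedPairs r E
relatedPairs-∷-map r f e₀ E r₀₀ r-₀ r-f rewrite r₀₀ = cong (count (r e₀) (map f E) +_) (old E)
  where
  old : ∀ E' → sum (map (λ e → count (r e) (e₀ ∷ map f E)) (map f E')) ≡ sum (map (λ e → count (r e) E) E')
  old []       = refl
  old (e ∷ E') rewrite r-₀ e = cong₂ _+_ (≡.trans (count-map (r (f e)) f E) (count-cong (r-f e) E)) (old E')

-- Gap k is the one just before vertex k.
straddles : ℕ → ℕ × ℕ → Bool
straddles k (a , b) = (a <ᵇ k) ∧ (k <ᵇ suc b)

endsBefore : ℕ → ℕ × ℕ → Bool
endsBefore k (a , b) = (a <ᵇ b) ∧ (b <ᵇ k)

pairCount-child : ∀ r (s : ℕ × ℕ → Bool) p k → k ≤ length p →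
  r (0 , suc k) (0 , suc k) ≡ false → (∀ e → r (shiftEdge k e) (0 , suc k) ≡ false) →
  (∀ e e' → r (shiftEdge k e) (shiftEdge k e') ≡ r e e') → (∀ e → r (0 , suc k) (shiftEdge k e) ≡ s e) →
  pairCount r (child p k) ≡ pairCount r p + count s (edges p)
pairCount-child r s p k k≤n r₀₀ r-₀ r-shift r₀-shift = begin
  relatedPairs r (edges (child p k))
    ≡⟨ cong (relatedPairs r) (edges-child p k k≤n) ⟩
  relatedPairs r ((0 , suc k) ∷ map (shiftEdge k) (edges p))
    ≡⟨ relatedPairs-∷-map r (shiftEdge k) (0 , suc k) (edges p) r₀₀ r-₀ r-shift ⟩
  count (r (0 , suc k)) (map (shiftEdge k) (edges p)) + relatedPairs r (edges p)
    ≡⟨ cong (_+ relatedPairs r (edges p)) (≡.trans (count-map _ (shiftEdge k) (edges p)) (count-cong r₀-shift (edges p))) ⟩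
  count s (edges p) + relatedPairs r (edges p)
    ≡⟨ +-comm (count s (edges p)) _ ⟩
  relatedPairs r (edges p) + count s (edges p) ∎
  where open ≡.≡-Reasoning

cr-child : ∀ p k → k ≤ length p → cr (child p k) ≡ cr p + count (straddles k) (edges p)
cr-child p k k≤n = pairCount-child crosses (straddles k) p k k≤n refl (λ e → refl) shifted new
  where
  shifted : ∀ e e' → crosses (shiftEdge k e) (shiftEdge k e') ≡ crosses e e'
  shifted (a , b) (c , d) rewrite shiftAt-<ᵇ-shiftAt k a c | shiftAt-<ᵇ-shiftAt k c b | shiftAt-<ᵇ-shiftAt k b d = refl
  new : ∀ e → crosses (0 , suc k) (shiftEdge k e) ≡ straddles k e
  new (a , b) rewrite 0<ᵇshiftAt k a | shiftAt-<ᵇ-suc a (≤-refl {k}) | suc-<ᵇ-shiftAt b (≤-refl {k}) = refl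

ne-child : ∀ p k → k ≤ length p → ne (child p k) ≡ ne p + count (endsBefore k) (edges p)
ne-child p k k≤n = pairCount-child nests (endsBefore k) p k k≤n refl (λ e → refl) shifted new
  where
  shifted : ∀ e e' → nests (shiftEdge k e) (shiftEdge k e') ≡ nests e e'
  shifted (a , b) (c , d) rewrite shiftAt-<ᵇ-shiftAt k a c | shiftAt-<ᵇ-shiftAt k c d | shiftAt-<ᵇ-shiftAt k d b = refl
  new : ∀ e → nests (0 , suc k) (shiftEdge k e) ≡ endsBefore k e
  new (a , b) rewrite 0<ᵇshiftAt k a | shiftAt-<ᵇ-shiftAt k a b | shiftAt-<ᵇ-suc b (≤-refl {k}) = refl

-- Profiles and descendants

applyUpTo-cong : ∀ {A : Set} {f g : ℕ → A} → (∀ i → f i ≡ g i) → ∀ n → applyUpTo f n ≡ applyUpTo g n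
applyUpTo-cong {f = f} {g} f≗g n = ≡.trans (≡.sym (map-upTo f n)) (≡.trans (map-cong f≗g (upTo n)) (map-upTo g n))

at-applyUpTo : ∀ (f : ℕ → ℕ) n i → i < n → at (applyUpTo f n) i ≡ f i
at-applyUpTo f (suc n) zero    _         = refl
at-applyUpTo f (suc n) (suc i) (s≤s i<n) = at-applyUpTo (λ j → f (suc j)) n i i<n

-- The profile of the child with new edge {0, k+1}, without its leading 0: entry k is doubled, and
-- the entries up to the first copy (crossings) resp. from the second copy on (nestings) grow by one.
crossInsert : ℕ → List ℕ → List ℕ
crossInsert k       []      = []
crossInsert zero    (x ∷ h) = suc x ∷ x ∷ h
crossInsert (suc k) (x ∷ h) = suc x ∷ crossInsert k h

nestInsert : ℕ → List ℕ → List ℕ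
nestInsert k       []      = []
nestInsert zero    (x ∷ h) = x ∷ suc x ∷ map suc h
nestInsert (suc k) (x ∷ h) = x ∷ nestInsert k h

crossBranching-explicit : ∀ h → crossBranching h ≡ applyUpTo (λ k → (at h k , crossInsert k h)) (length h)
crossBranching-explicit []      = refl
crossBranching-explicit (x ∷ h) = cong ((x , suc x ∷ x ∷ h) ∷_)
  (≡.trans (cong (map (map₂ (suc x ∷_))) (crossBranching-explicit h)) (map-applyUpTo _ (map₂ (suc x ∷_)) (length h)))

nestBranching-explicit : ∀ h → nestBranching h ≡ applyUpTo (λ k → (at h k , nestInsert k h)) (length h)
nestBranching-explicit []      = refl
nestBranching-explicit (x ∷ h) = cong ((x , x ∷ suc x ∷ map suc h) ∷_)
  (≡.trans (cong (map (map₂ (x ∷_))) (nestBranching-explicit h)) (map-applyUpTo _ (map₂ (x ∷_)) (length h)))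

crossInsert-applyUpTo : ∀ (f g : ℕ → ℕ) k n → k < n →
  (∀ i → i ≤ k → g i ≡ suc (f i)) → (∀ i → k ≤ i → g (suc i) ≡ f i) →
  applyUpTo g (suc n) ≡ crossInsert k (applyUpTo f n)
crossInsert-applyUpTo f g zero    (suc n) _         lo hi =
  cong₂ _∷_ (lo 0 z≤n) (applyUpTo-cong (λ i → hi i z≤n) (suc n))
crossInsert-applyUpTo f g (suc k) (suc n) (s≤s k<n) lo hi =
  cong₂ _∷_ (lo 0 z≤n) (crossInsert-applyUpTo (λ i → f (suc i)) (λ i → g (suc i)) k n k<n
                          (λ i i≤k → lo (suc i) (s≤s i≤k)) (λ i k≤i → hi (suc i) (s≤s k≤i)))

nestInsert-applyUpTo : ∀ (f g : ℕ → ℕ) k n → k < n →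
  (∀ i → i ≤ k → g i ≡ f i) → (∀ i → k ≤ i → g (suc i) ≡ suc (f i)) →
  applyUpTo g (suc n) ≡ nestInsert k (applyUpTo f n)
nestInsert-applyUpTo f g zero    (suc n) _         lo hi =
  cong₂ _∷_ (lo 0 z≤n) (≡.trans (applyUpTo-cong (λ i → hi i z≤n) (suc n)) (≡.sym (map-applyUpTo f suc (suc n))))
nestInsert-applyUpTo f g (suc k) (suc n) (s≤s k<n) lo hi =
  cong₂ _∷_ (lo 0 z≤n) (nestInsert-applyUpTo (λ i → f (suc i)) (λ i → g (suc i)) k n k<n
                          (λ i i≤k → lo (suc i) (s≤s i≤k)) (λ i k≤i → hi (suc i) (s≤s k≤i)))

profile : (ℕ → ℕ × ℕ → Bool) → List ℕ → List ℕ
profile P p = map (λ j → count (P j) (edges p)) (upTo (suc (length p)))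

crossProfile : List ℕ → List ℕ
crossProfile = profile straddles

nestProfile : List ℕ → List ℕ
nestProfile = profile endsBefore

length-profile : ∀ P p → length (profile P p) ≡ suc (length p)
length-profile P p = ≡.trans (length-map _ (upTo (suc (length p)))) (length-upTo (suc (length p)))

at-profile : ∀ P p k → k ≤ length p → at (profile P p) k ≡ count (P k) (edges p)
at-profile P p k k≤n = ≡.trans (cong (λ h → at h k) (map-upTo _ (suc (length p))))
                               (at-applyUpTo (λ j → count (P j) (edges p)) (suc (length p)) k (s≤s k≤n))

length-child : ∀ p k → length (child p k) ≡ suc (suc (length p))
length-child p k = cong suc (begin
  length (map (shiftAt k) (take k p) ++ 0 ∷ map (shiftAt k) (drop k p))
    ≡⟨ length-++-sucʳ (map (shiftAt k) (take k p)) 0 _ ⟩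
  suc (length (map (shiftAt k) (take k p) ++ map (shiftAt k) (drop k p)))
    ≡⟨ cong (λ q → suc (length q)) (map-++ (shiftAt k) (take k p) (drop k p)) ⟨
  suc (length (map (shiftAt k) (take k p ++ drop k p)))
    ≡⟨ cong (λ q → suc (length (map (shiftAt k) q))) (take++drop≡id k p) ⟩
  suc (length (map (shiftAt k) p))
    ≡⟨ cong suc (length-map (shiftAt k) p) ⟩
  suc (length p) ∎)
  where open ≡.≡-Reasoning

count-false : ∀ {A : Set} (g : A → Bool) → (∀ x → g x ≡ false) → ∀ xs → count g xs ≡ 0
count-false g g≡false []       = refl
count-false g g≡false (x ∷ xs) rewrite g≡false x = count-false g g≡false xs

profile-applyUpTo : ∀ P q → profile P q ≡ applyUpTo (λ j → count (P j) (edges q)) (suc (length q))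
profile-applyUpTo P q = map-upTo _ (suc (length q))

count-child : ∀ Q p k → k ≤ length p →
  count Q (edges (child p k)) ≡ ind (Q (0 , suc k)) + count (λ e → Q (shiftEdge k e)) (edges p)
count-child Q p k k≤n = ≡.trans (cong (count Q) (edges-child p k k≤n))
  (cong (ind (Q (0 , suc k)) +_) (count-map Q (shiftEdge k) (edges p)))

straddles-shiftEdge-≤ : ∀ {i k} e → i ≤ k → straddles (suc i) (shiftEdge k e) ≡ straddles i e
straddles-shiftEdge-≤ (a , b) i≤k rewrite shiftAt-<ᵇ-suc a i≤k | <ᵇ-shiftAt b i≤k = refl

straddles-shiftEdge-≥ : ∀ {i k} e → k ≤ i → straddles (suc (suc i)) (shiftEdge k e) ≡ straddles i e
straddles-shiftEdge-≥ (a , b) k≤i rewrite shiftAt-<ᵇ-2+ a k≤i | suc-<ᵇ-shiftAt b k≤i = refl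

endsBefore-shiftEdge-≤ : ∀ {i k} e → i ≤ k → endsBefore (suc i) (shiftEdge k e) ≡ endsBefore i e
endsBefore-shiftEdge-≤ {k = k} (a , b) i≤k rewrite shiftAt-<ᵇ-shiftAt k a b | shiftAt-<ᵇ-suc b i≤k = refl

endsBefore-shiftEdge-≥ : ∀ {i k} e → k ≤ i → endsBefore (suc (suc i)) (shiftEdge k e) ≡ endsBefore i e
endsBefore-shiftEdge-≥ {k = k} (a , b) k≤i rewrite shiftAt-<ᵇ-shiftAt k a b | shiftAt-<ᵇ-2+ b k≤i = refl

crossProfile-child : ∀ p k → k ≤ length p → crossProfile (child p k) ≡ 0 ∷ crossInsert k (crossProfile p)
crossProfile-child p k k≤n = begin
  profile straddles (child p k)
    ≡⟨ profile-applyUpTo straddles (child p k) ⟩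
  applyUpTo (λ j → count (straddles j) E') (suc (length (child p k)))
    ≡⟨ cong (λ m → applyUpTo (λ j → count (straddles j) E') (suc m)) (length-child p k) ⟩
  count (straddles 0) E' ∷ applyUpTo g (suc (suc (length p)))
    ≡⟨ cong₂ _∷_ none (crossInsert-applyUpTo f g k (suc (length p)) (s≤s k≤n) lo hi) ⟩
  0 ∷ crossInsert k (applyUpTo f (suc (length p)))
    ≡⟨ cong (λ h → 0 ∷ crossInsert k h) (profile-applyUpTo straddles p) ⟨
  0 ∷ crossInsert k (crossProfile p) ∎
  where
  open ≡.≡-Reasoning
  E' = edges (child p k)
  f = λ j → count (straddles j) (edges p)
  g = λ i → count (straddles (suc i)) E'
  none : count (straddles 0) E' ≡ 0
  none = ≡.trans (count-child (straddles 0) p k k≤n) (count-false _ (λ _ → refl) (edges p))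
  lo : ∀ i → i ≤ k → g i ≡ suc (f i)
  lo i i≤k = ≡.trans (count-child (straddles (suc i)) p k k≤n)
    (cong₂ (λ b n → ind b + n) (<ᵇ-true (s≤s i≤k)) (count-cong (λ e → straddles-shiftEdge-≤ e i≤k) (edges p)))
  hi : ∀ i → k ≤ i → g (suc i) ≡ f i
  hi i k≤i = ≡.trans (count-child (straddles (suc (suc i))) p k k≤n)
    (cong₂ (λ b n → ind b + n) (<ᵇ-false k≤i) (count-cong (λ e → straddles-shiftEdge-≥ e k≤i) (edges p)))

nestProfile-child : ∀ p k → k ≤ length p → nestProfile (child p k) ≡ 0 ∷ nestInsert k (nestProfile p)
nestProfile-child p k k≤n = begin
  profile endsBefore (child p k)
    ≡⟨ profile-applyUpTo endsBefore (child p k) ⟩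
  applyUpTo (λ j → count (endsBefore j) E') (suc (length (child p k)))
    ≡⟨ cong (λ m → applyUpTo (λ j → count (endsBefore j) E') (suc m)) (length-child p k) ⟩
  count (endsBefore 0) E' ∷ applyUpTo g (suc (suc (length p)))
    ≡⟨ cong₂ _∷_ none (nestInsert-applyUpTo f g k (suc (length p)) (s≤s k≤n) lo hi) ⟩
  0 ∷ nestInsert k (applyUpTo f (suc (length p)))
    ≡⟨ cong (λ h → 0 ∷ nestInsert k h) (profile-applyUpTo endsBefore p) ⟨
  0 ∷ nestInsert k (nestProfile p) ∎
  where
  open ≡.≡-Reasoning
  E' = edges (child p k)
  f = λ j → count (endsBefore j) (edges p)
  g = λ i → count (endsBefore (suc i)) E'
  none : count (endsBefore 0) E' ≡ 0
  none = ≡.trans (count-child (endsBefore 0) p k k≤n) (count-false _ (λ _ → ∧-zeroʳ _) (edges p))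
  lo : ∀ i → i ≤ k → g i ≡ f i
  lo i i≤k = ≡.trans (count-child (endsBefore (suc i)) p k k≤n)
    (cong₂ (λ b n → ind b + n) (<ᵇ-false i≤k) (count-cong (λ e → endsBefore-shiftEdge-≤ e i≤k) (edges p)))
  hi : ∀ i → k ≤ i → g (suc i) ≡ suc (f i)
  hi i k≤i = ≡.trans (count-child (endsBefore (suc (suc i))) p k k≤n)
    (cong₂ (λ b n → ind b + n) (<ᵇ-true (s≤s k≤i)) (count-cong (λ e → endsBefore-shiftEdge-≥ e k≤i) (edges p)))

𝒯-suc : ∀ p l → 𝒯 p (suc l) ≡ concatMap (λ q → 𝒯 q l) (children p)
𝒯-suc p zero    = ≡.trans (++-identityʳ (children p)) (≡.sym (concatMap-pure (children p)))
𝒯-suc p (suc l) = ≡.trans (cong (concatMap children) (𝒯-suc p l)) (concatMap-concatMap children (λ q → 𝒯 q l) (children p))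

module Descendants (stat : List ℕ → ℕ) (prof : List ℕ → List ℕ) (insert : ℕ → List ℕ → List ℕ) (br : Branching)
  (length-prof : ∀ p → length (prof p) ≡ suc (length p))
  (br-explicit : ∀ h → br h ≡ applyUpTo (λ k → (at h k , insert k h)) (length h))
  (stat-child : ∀ p k → k ≤ length p → stat (child p k) ≡ stat p + at (prof p) k)
  (prof-child : ∀ p k → k ≤ length p → prof (child p k) ≡ 0 ∷ insert k (prof p)) where

  stat-𝒯 : ∀ l p → map stat (𝒯 p l) ↭ stat p ⊕ pathWeights br l (prof p)
  stat-𝒯 zero    p = ↭-reflexive (cong [_] (≡.sym (+-identityʳ (stat p))))
  stat-𝒯 (suc l) p = begin
    map stat (𝒯 p (suc l))
      ≡⟨ cong (map stat) (𝒯-suc p l) ⟩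
    map stat (concatMap (λ q → 𝒯 q l) (map (child p) (upTo (suc (length p)))))
      ≡⟨ map-concatMap stat (λ q → 𝒯 q l) (children p) ⟩
    concatMap (λ q → map stat (𝒯 q l)) (map (child p) (upTo (suc (length p))))
      ≡⟨ concatMap-map (λ q → map stat (𝒯 q l)) (child p) U ⟩
    concatMap (λ k → map stat (𝒯 (child p k) l)) (upTo (suc (length p)))
      ↭⟨ concatMap-cong-↭-∈ (upTo (suc (length p))) (λ k k∈ → subtree k (≤-pred (∈-upTo⁻ k∈))) ⟩
    concatMap (λ k → stat p ⊕ W (at h k , insert k h)) (upTo (suc (length p)))
      ≡⟨ ⊕-concatMap (stat p) (λ k → W (at h k , insert k h)) U ⟨
    stat p ⊕ concatMap (λ k → W (at h k , insert k h)) (upTo (suc (length p)))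
      ≡⟨ cong (stat p ⊕_) (concatMap-map W (λ k → (at h k , insert k h)) U) ⟨
    stat p ⊕ concatMap W (map (λ k → (at h k , insert k h)) (upTo (suc (length p))))
      ≡⟨ cong (λ ks → stat p ⊕ concatMap W ks) children-weights ⟩
    stat p ⊕ pathWeights br (suc l) h ∎
    where
    open PermutationReasoning
    U = upTo (suc (length p))
    h = prof p
    W = weighted (λ t → pathWeights br l (0 ∷ t))
    children-weights : map (λ k → (at h k , insert k h)) (upTo (suc (length p))) ≡ br h
    children-weights = ≡.trans (map-upTo _ (suc (length p)))
      (≡.trans (cong (applyUpTo _) (≡.sym (length-prof p))) (≡.sym (br-explicit h)))
    subtree : ∀ k → k ≤ length p → map stat (𝒯 (child p k) l) ↭ stat p ⊕ W (at h k , insert k h)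
    subtree k k≤n = ↭-trans (stat-𝒯 l (child p k)) (↭-reflexive
      (≡.trans (cong₂ (λ s t → s ⊕ pathWeights br l t) (stat-child p k k≤n) (prof-child p k k≤n))
               (≡.sym (⊕-⊕ (stat p) (at h k) _))))

cr-𝒯 : ∀ l p → map cr (𝒯 p l) ↭ cr p ⊕ pathWeights crossBranching l (crossProfile p)
cr-𝒯 = Descendants.stat-𝒯 cr crossProfile crossInsert crossBranching (length-profile straddles) crossBranching-explicit
  (λ p k k≤n → ≡.trans (cr-child p k k≤n) (cong (cr p +_) (≡.sym (at-profile straddles p k k≤n)))) crossProfile-child

ne-𝒯 : ∀ l p → map ne (𝒯 p l) ↭ ne p ⊕ pathWeights nestBranching l (nestProfile p)
ne-𝒯 = Descendants.stat-𝒯 ne nestProfile nestInsert nestBranching (length-profile endsBefore) nestBranching-explicit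
  (λ p k k≤n → ≡.trans (ne-child p k k≤n) (cong (ne p +_) (≡.sym (at-profile endsBefore p k k≤n)))) nestProfile-child

-- The matchings Mₙ and Nₙ

map-∸-upTo : ∀ m → map (λ i → m ∸ suc i) (upTo m) ≡ downFrom m
map-∸-upTo zero    = refl
map-∸-upTo (suc m) = cong (m ∷_) (begin
  map (λ i → suc m ∸ suc i) (applyUpTo suc m) ≡⟨ cong (map (λ i → suc m ∸ suc i)) (map-upTo suc m) ⟨
  map (λ i → suc m ∸ suc i) (map suc (upTo m)) ≡⟨ map-∘ (upTo m) ⟨
  map (λ i → m ∸ suc i) (upTo m)               ≡⟨ map-∸-upTo m ⟩
  downFrom m                                   ∎)
  where open ≡.≡-Reasoning

Mₙ≡downFrom : ∀ n → Mₙ n ≡ downFrom (2 * n)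
Mₙ≡downFrom n = map-∸-upTo (2 * n)

length-Mₙ : ∀ n → length (Mₙ n) ≡ 2 * n
length-Mₙ n = ≡.trans (cong length (Mₙ≡downFrom n)) (length-downFrom (2 * n))

child-last : ∀ p → All (_< length p) p → child p (length p) ≡ suc (length p) ∷ map suc p ++ [ 0 ]
child-last p p<n = cong (suc (length p) ∷_) (≡.trans
  (cong₂ (λ xs ys → map (shiftAt (length p)) xs ++ 0 ∷ map (shiftAt (length p)) ys)
         (take-all (length p) p ≤-refl) (drop-all (length p) p ≤-refl))
  (cong (_++ [ 0 ]) (map-cong-local (All.map shiftAt-< p<n))))

downFrom-suc : ∀ m → downFrom (suc m) ≡ map suc (downFrom m) ++ [ 0 ]
downFrom-suc m = ≡.trans (≡.sym (downFrom-∷ʳ m)) (cong (_++ [ 0 ]) (≡.sym (map-applyDownFrom (λ i → i) suc m)))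

Mₙ-suc : ∀ n → Mₙ (suc n) ≡ child (Mₙ n) (2 * n)
Mₙ-suc n = begin
  Mₙ (suc n)                                         ≡⟨ Mₙ≡downFrom (suc n) ⟩
  downFrom (2 * suc n)                               ≡⟨ cong downFrom (*-suc 2 n) ⟩
  suc (2 * n) ∷ downFrom (suc (2 * n))               ≡⟨ cong (suc (2 * n) ∷_) (downFrom-suc (2 * n)) ⟩
  suc (2 * n) ∷ map suc (downFrom (2 * n)) ++ [ 0 ]  ≡⟨ cong (λ m → suc m ∷ map suc (downFrom (2 * n)) ++ [ 0 ]) |D| ⟨
  suc (length D) ∷ map suc D ++ [ 0 ]                ≡⟨ child-last D D<|D| ⟨
  child D (length D)                                 ≡⟨ cong₂ child (Mₙ≡downFrom n) (≡.sym |D|) ⟨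
  child (Mₙ n) (2 * n)                               ∎
  where
  open ≡.≡-Reasoning
  D = downFrom (2 * n)
  |D| = length-downFrom (2 * n)
  D<|D| : All (_< length D) D
  D<|D| = ≡.subst (λ m → All (_< m) D) (≡.sym |D|) (applyDownFrom⁺₁ (λ i → i) (2 * n) (λ i<2n → i<2n))

Nₙ-suc : ∀ n → Nₙ (suc n) ≡ child (Nₙ n) 0
Nₙ-suc n = cong (λ xs → 1 ∷ 0 ∷ xs) (begin
  concatMap pair (applyUpTo suc n)                      ≡⟨ cong (concatMap pair) (map-upTo suc n) ⟨
  concatMap pair (map suc (upTo n))                     ≡⟨ concatMap-map pair suc (upTo n) ⟩
  concatMap (λ j → pair (suc j)) (upTo n)               ≡⟨ concatMap-cong (λ j → cong (λ m → suc m ∷ m ∷ []) (*-suc 2 j)) (upTo n) ⟩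
  concatMap (λ j → map (shiftAt 0) (pair j)) (upTo n)   ≡⟨ map-concatMap (shiftAt 0) pair (upTo n) ⟨
  map (shiftAt 0) (concatMap pair (upTo n))             ∎)
  where
  open ≡.≡-Reasoning
  pair = λ j → suc (2 * j) ∷ 2 * j ∷ []

length-Nₙ : ∀ n → length (Nₙ n) ≡ 2 * n
length-Nₙ zero    = refl
length-Nₙ (suc n) = begin
  length (Nₙ (suc n))          ≡⟨ cong length (Nₙ-suc n) ⟩
  length (child (Nₙ n) 0)      ≡⟨ length-child (Nₙ n) 0 ⟩
  suc (suc (length (Nₙ n)))    ≡⟨ cong (λ m → suc (suc m)) (length-Nₙ n) ⟩
  suc (suc (2 * n))            ≡⟨ *-suc 2 n ⟨
  2 * suc n                    ∎
  where open ≡.≡-Reasoning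

pyramid : ℕ → List ℕ
pyramid zero    = []
pyramid (suc n) = 0 ∷ map suc (pyramid n ++ [ 0 ])

staircase : ℕ → List ℕ
staircase zero    = [ 0 ]
staircase (suc n) = 0 ∷ 0 ∷ map suc (staircase n)

length-pyramid : ∀ n → length (pyramid n) ≡ 2 * n
length-pyramid zero    = refl
length-pyramid (suc n) = begin
  suc (length (map suc (pyramid n ++ [ 0 ])))  ≡⟨ cong suc (length-map suc (pyramid n ++ [ 0 ])) ⟩
  suc (length (pyramid n ++ [ 0 ]))            ≡⟨ cong suc (List.length-++-sucʳ (pyramid n) 0 []) ⟩
  suc (suc (length (pyramid n ++ [])))         ≡⟨ cong (λ xs → suc (suc (length xs))) (++-identityʳ (pyramid n)) ⟩
  suc (suc (length (pyramid n)))               ≡⟨ cong (λ m → suc (suc m)) (length-pyramid n) ⟩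
  suc (suc (2 * n))                            ≡⟨ *-suc 2 n ⟨
  2 * suc n                                    ∎
  where open ≡.≡-Reasoning

pyramid-↭-staircase : ∀ n → pyramid n ++ [ 0 ] ↭ staircase n
pyramid-↭-staircase zero    = ↭-refl
pyramid-↭-staircase (suc n) = ↭-prep 0 (↭-trans (++-comm (map suc (pyramid n ++ [ 0 ])) [ 0 ])
                                                  (↭-prep 0 (map⁺ suc (pyramid-↭-staircase n))))

crossInsert-last : ∀ xs y → crossInsert (length xs) (xs ++ [ y ]) ≡ map suc xs ++ suc y ∷ y ∷ []
crossInsert-last []       y = refl
crossInsert-last (x ∷ xs) y = cong (suc x ∷_) (crossInsert-last xs y)

at-length : ∀ xs y (ys : List ℕ) → at (xs ++ y ∷ ys) (length xs) ≡ y
at-length []       y ys = refl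
at-length (x ∷ xs) y ys = at-length xs y ys

crossProfile-Mₙ : ∀ n → crossProfile (Mₙ n) ≡ pyramid n ++ [ 0 ]
crossProfile-Mₙ zero    = refl
crossProfile-Mₙ (suc n) = begin
  crossProfile (Mₙ (suc n))                                ≡⟨ cong crossProfile (Mₙ-suc n) ⟩
  crossProfile (child (Mₙ n) (2 * n))                      ≡⟨ crossProfile-child (Mₙ n) (2 * n) 2n≤|Mₙ| ⟩
  0 ∷ crossInsert (2 * n) (crossProfile (Mₙ n))            ≡⟨ cong₂ (λ k h → 0 ∷ crossInsert k h) (≡.sym (length-pyramid n)) (crossProfile-Mₙ n) ⟩
  0 ∷ crossInsert (length P) (P ++ [ 0 ])                  ≡⟨ cong (0 ∷_) (crossInsert-last P 0) ⟩
  0 ∷ map suc P ++ [ 1 ] ++ [ 0 ]                          ≡⟨ cong (0 ∷_) (List.++-assoc (map suc P) [ 1 ] [ 0 ]) ⟨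
  0 ∷ (map suc P ++ [ 1 ]) ++ [ 0 ]                        ≡⟨ cong (λ xs → 0 ∷ xs ++ [ 0 ]) (map-++ suc P [ 0 ]) ⟨
  pyramid (suc n) ++ [ 0 ]                                 ∎
  where
  open ≡.≡-Reasoning
  P = pyramid n
  2n≤|Mₙ| = ≤-reflexive (≡.sym (length-Mₙ n))

cr-Mₙ : ∀ n → cr (Mₙ n) ≡ 0
cr-Mₙ zero    = refl
cr-Mₙ (suc n) = begin
  cr (Mₙ (suc n))                                       ≡⟨ cong cr (Mₙ-suc n) ⟩
  cr (child (Mₙ n) (2 * n))                             ≡⟨ cr-child (Mₙ n) (2 * n) 2n≤|Mₙ| ⟩
  cr (Mₙ n) + count (straddles (2 * n)) (edges (Mₙ n)) ≡⟨ cong₂ _+_ (cr-Mₙ n) (≡.sym (at-profile straddles (Mₙ n) (2 * n) 2n≤|Mₙ|)) ⟩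
  at (crossProfile (Mₙ n)) (2 * n)                      ≡⟨ cong₂ at (crossProfile-Mₙ n) (≡.sym (length-pyramid n)) ⟩
  at (pyramid n ++ [ 0 ]) (length (pyramid n))          ≡⟨ at-length (pyramid n) 0 [] ⟩
  0                                                     ∎
  where
  open ≡.≡-Reasoning
  2n≤|Mₙ| = ≤-reflexive (≡.sym (length-Mₙ n))

nestProfile-Nₙ : ∀ n → nestProfile (Nₙ n) ≡ staircase n
nestProfile-Nₙ zero    = refl
nestProfile-Nₙ (suc n) = begin
  nestProfile (Nₙ (suc n))               ≡⟨ cong nestProfile (Nₙ-suc n) ⟩
  nestProfile (child (Nₙ n) 0)           ≡⟨ nestProfile-child (Nₙ n) 0 z≤n ⟩
  0 ∷ nestInsert 0 (nestProfile (Nₙ n))  ≡⟨ cong (λ h → 0 ∷ nestInsert 0 h) (nestProfile-Nₙ n) ⟩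
  0 ∷ nestInsert 0 (staircase n)         ≡⟨ cong (0 ∷_) (nestInsert-staircase n) ⟩
  staircase (suc n)                      ∎
  where
  open ≡.≡-Reasoning
  nestInsert-staircase : ∀ n → nestInsert 0 (staircase n) ≡ 0 ∷ map suc (staircase n)
  nestInsert-staircase zero    = refl
  nestInsert-staircase (suc n) = refl

ne-Nₙ : ∀ n → ne (Nₙ n) ≡ 0
ne-Nₙ zero    = refl
ne-Nₙ (suc n) = begin
  ne (Nₙ (suc n))                              ≡⟨ cong ne (Nₙ-suc n) ⟩
  ne (child (Nₙ n) 0)                          ≡⟨ ne-child (Nₙ n) 0 z≤n ⟩
  ne (Nₙ n) + count (endsBefore 0) (edges (Nₙ n)) ≡⟨ cong₂ _+_ (ne-Nₙ n) (≡.sym (at-profile endsBefore (Nₙ n) 0 z≤n)) ⟩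
  at (nestProfile (Nₙ n)) 0                    ≡⟨ cong (λ h → at h 0) (nestProfile-Nₙ n) ⟩
  at (staircase n) 0                           ≡⟨ head-staircase n ⟩
  0                                            ∎
  where
  open ≡.≡-Reasoning
  head-staircase : ∀ n → at (staircase n) 0 ≡ 0
  head-staircase zero    = refl
  head-staircase (suc n) = refl

𝒯-Mₙ-Nₙ : ∀ n l → map cr (𝒯 (Mₙ n) l) ↭ map ne (𝒯 (Nₙ n) l)
𝒯-Mₙ-Nₙ n l = begin
  map cr (𝒯 (Mₙ n) l)
    ↭⟨ cr-𝒯 l (Mₙ n) ⟩
  cr (Mₙ n) ⊕ pathWeights crossBranching l (crossProfile (Mₙ n))
    ≡⟨ cong₂ (λ c h → c ⊕ pathWeights crossBranching l h) (cr-Mₙ n) (crossProfile-Mₙ n) ⟩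
  0 ⊕ pathWeights crossBranching l (pyramid n ++ [ 0 ])
    ≡⟨ ⊕-identityˡ _ ⟩
  pathWeights crossBranching l (pyramid n ++ [ 0 ])
    ↭⟨ pathWeights-↭ crossBranching-telescoping nestBranching-telescoping l (pyramid-↭-staircase n) ⟩
  pathWeights nestBranching l (staircase n)
    ≡⟨ ⊕-identityˡ _ ⟨
  0 ⊕ pathWeights nestBranching l (staircase n)
    ≡⟨ cong₂ (λ c h → c ⊕ pathWeights nestBranching l h) (ne-Nₙ n) (nestProfile-Nₙ n) ⟨
  ne (Nₙ n) ⊕ pathWeights nestBranching l (nestProfile (Nₙ n))
    ↭⟨ ne-𝒯 l (Nₙ n) ⟨
  map ne (𝒯 (Nₙ n) l) ∎
  where open PermutationReasoning

-- Openers and closers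

count-++ : ∀ {A : Set} (f : A → Bool) xs ys → count f (xs ++ ys) ≡ count f xs + count f ys
count-++ f []       ys = refl
count-++ f (x ∷ xs) ys = ≡.trans (cong (ind (f x) +_) (count-++ f xs ys)) (≡.sym (+-assoc (ind (f x)) _ _))

count-upTo-suc : ∀ (f : ℕ → Bool) j → count f (upTo (suc j)) ≡ count f (upTo j) + ind (f j)
count-upTo-suc f j = begin
  count f (upTo (suc j))           ≡⟨ cong (count f) (upTo-∷ʳ j) ⟨
  count f (upTo j ++ [ j ])        ≡⟨ count-++ f (upTo j) [ j ] ⟩
  count f (upTo j) + (ind (f j) + 0) ≡⟨ cong (count f (upTo j) +_) (+-identityʳ (ind (f j))) ⟩
  count f (upTo j) + ind (f j)     ∎
  where open ≡.≡-Reasoning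

count-filter : ∀ {A : Set} {p : Level} {P : Pred A p} (P? : Decidable P) (g : A → Bool) xs →
  count g (filter P? xs) ≡ count (λ x → does (P? x) ∧ g x) xs
count-filter P? g []       = refl
count-filter P? g (x ∷ xs) with does (P? x)
... | true  = cong (ind (g x) +_) (count-filter P? g xs)
... | false = count-filter P? g xs

count-cong-∈ : ∀ {A : Set} {f g : A → Bool} xs → (∀ x → x ∈ xs → f x ≡ g x) → count f xs ≡ count g xs
count-cong-∈ []       f≡g = refl
count-cong-∈ (x ∷ xs) f≡g = cong₂ (λ b n → ind b + n) (f≡g x (here refl)) (count-cong-∈ xs (λ y y∈ → f≡g y (there y∈)))

count-+ : ∀ {A : Set} {f g h : A → Bool} → (∀ x → ind (f x) + ind (g x) ≡ ind (h x)) →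
  ∀ xs → count f xs + count g xs ≡ count h xs
count-+ f+g≡h []       = refl
count-+ {f = f} {g} {h} f+g≡h (x ∷ xs) =
  ≡.trans (+-interchange (ind (f x)) (count f xs) (ind (g x)) (count g xs)) (cong₂ _+_ (f+g≡h x) (count-+ f+g≡h xs))

count-single : ∀ (b : ℕ → Bool) j m → j < m → count (λ i → b i ∧ does (i ≟ j)) (upTo m) ≡ ind (b j)
count-single b j (suc m) (s≤s j≤m) = ≡.trans (count-upTo-suc _ m) (last (m≤n⇒m<n∨m≡n j≤m))
  where
  last : j < m ⊎ j ≡ m → count (λ i → b i ∧ does (i ≟ j)) (upTo m) + ind (b m ∧ does (m ≟ j)) ≡ ind (b j)
  last (inj₁ j<m) rewrite dec-false (m ≟ j) (λ m≡j → <-irrefl (≡.sym m≡j) j<m) | ∧-zeroʳ (b m) =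
    ≡.trans (+-identityʳ _) (count-single b j m j<m)
  last (inj₂ refl) rewrite dec-true (j ≟ j) refl | ∧-identityʳ (b j) =
    cong (_+ ind (b j)) (≡.trans (count-cong-∈ (upTo j) below) (count-false (λ _ → false) (λ _ → refl) (upTo j)))
    where
    below : ∀ i → i ∈ upTo j → b i ∧ does (i ≟ j) ≡ false
    below i i∈ rewrite dec-false (i ≟ j) (λ i≡j → <-irrefl i≡j (∈-upTo⁻ i∈)) = ∧-zeroʳ (b i)

straddles-split : ∀ j {a b} → a < b → ind (straddles j (a , b)) + ind (b <ᵇ j) ≡ ind (a <ᵇ j)
straddles-split j {a} {b} a<b with <ᵇ-cases b j
... | inj₁ (b<j , b<ᵇj) rewrite b<ᵇj | <ᵇ-false {j} {suc b} b<j | <ᵇ-true (≤-trans (m≤n⇒m≤1+n a<b) b<j) = refl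
... | inj₂ (j≤b , b≮ᵇj) rewrite b≮ᵇj | <ᵇ-true {j} {suc b} (s≤s j≤b) | ∧-identityʳ (a <ᵇ j) = +-identityʳ _

<ᵇ-suc : ∀ x j → ind (x <ᵇ suc j) ≡ ind (x <ᵇ j) + ind (does (x ≟ j))
<ᵇ-suc zero    zero    = refl
<ᵇ-suc zero    (suc j) = refl
<ᵇ-suc (suc x) zero    = refl
<ᵇ-suc (suc x) (suc j) = <ᵇ-suc x j

∧-<ᵇ-suc : ∀ b x j → ind (b ∧ (x <ᵇ j)) + ind (b ∧ does (x ≟ j)) ≡ ind (b ∧ (x <ᵇ suc j))
∧-<ᵇ-suc false x j = refl
∧-<ᵇ-suc true  x j = ≡.sym (<ᵇ-suc x j)

half : ∀ {x n} → x + x ≡ n + n → x ≡ n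
half {x} {n} x+x≡n+n = *-cancelˡ-≡ x n 2 (≡.trans (cong (x +_) (+-identityʳ x)) (≡.trans x+x≡n+n (cong (n +_) (≡.sym (+-identityʳ n)))))

module MatchingCounts {n : ℕ} {p : List ℕ} (p-match : IsMatching n p) where

  open IsMatching p-match public

  partner : ℕ → ℕ
  partner = at p

  opens : ℕ → Bool
  opens i = i <ᵇ partner i

  closes : ℕ → Bool
  closes i = partner i <ᵇ i

  opened : ℕ → ℕ
  opened j = count (λ i → opens i ∧ (i <ᵇ j)) (upTo (2 * n))

  closed : ℕ → ℕ
  closed j = count (λ i → opens i ∧ (partner i <ᵇ j)) (upTo (2 * n))

  opens+closes : ∀ i → i < 2 * n → ind (opens i) + ind (closes i) ≡ 1
  opens+closes i i<2n with <ᵇ-cases i (partner i)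
  ... | inj₁ (i<Pi , e) rewrite e | <ᵇ-false (<⇒≤ i<Pi) = refl
  ... | inj₂ (Pi≤i , e) rewrite e | <ᵇ-true (≤∧≢⇒< Pi≤i (noFix i i<2n)) = refl

  count-edges : ∀ Q → count Q (edges p) ≡ count (λ i → opens i ∧ Q (i , partner i)) (upTo (2 * n))
  count-edges Q = ≡.trans (count-map Q (λ i → (i , partner i)) (filter (λ i → i <? partner i) (upTo (length p))))
    (≡.trans (count-filter (λ i → i <? partner i) _ (upTo (length p))) (cong (λ m → count (λ i → opens i ∧ Q (i , partner i)) (upTo m)) len))

  cross+closed : ∀ j → count (straddles j) (edges p) + closed j ≡ opened j
  cross+closed j = ≡.trans (cong (_+ closed j) (count-edges (straddles j))) (count-+ split (upTo (2 * n)))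
    where
    split : ∀ i → ind (opens i ∧ straddles j (i , partner i)) + ind (opens i ∧ (partner i <ᵇ j)) ≡ ind (opens i ∧ (i <ᵇ j))
    split i with i <ᵇ partner i in e
    ... | true  = straddles-split j (<ᵇ-true⁻ e)
    ... | false = refl

  nest≡closed : ∀ j → count (endsBefore j) (edges p) ≡ closed j
  nest≡closed j = ≡.trans (count-edges (endsBefore j))
    (count-cong (λ i → ≡.trans (≡.sym (∧-assoc (opens i) (opens i) _)) (cong (_∧ (partner i <ᵇ j)) (∧-idem (opens i)))) (upTo (2 * n)))

  opened-suc : ∀ j → j < 2 * n → opened (suc j) ≡ opened j + ind (opens j)
  opened-suc j j<2n = ≡.trans (≡.sym (count-+ (λ i → ∧-<ᵇ-suc (opens i) i j) (upTo (2 * n))))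
                              (cong (opened j +_) (count-single opens j (2 * n) j<2n))

  ends-at : ∀ i j → i < 2 * n → j < 2 * n → opens i ∧ does (partner i ≟ j) ≡ closes j ∧ does (i ≟ partner j)
  ends-at i j i<2n j<2n with partner i ≟ j
  ... | yes refl rewrite invol i i<2n | dec-true (i ≟ i) refl | dec-true (partner i ≟ partner i) refl = refl
  ... | no Pi≢j rewrite dec-false (partner i ≟ j) Pi≢j | dec-false (i ≟ partner j) (λ i≡Pj → Pi≢j (≡.trans (cong partner i≡Pj) (invol j j<2n))) =
    ≡.trans (∧-zeroʳ (opens i)) (≡.sym (∧-zeroʳ (closes j)))

  closed-suc : ∀ j → j < 2 * n → closed (suc j) ≡ closed j + ind (closes j)
  closed-suc j j<2n = ≡.trans (≡.sym (count-+ (λ i → ∧-<ᵇ-suc (opens i) (partner i) j) (upTo (2 * n))))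
    (cong (closed j +_) (≡.trans (count-cong-∈ (upTo (2 * n)) (λ i i∈ → ends-at i j (∈-upTo⁻ i∈) j<2n))
                                 (count-single (λ _ → closes j) (partner j) (2 * n) (inRange j j<2n))))

  opened-zero : opened 0 ≡ 0
  opened-zero = count-false _ (λ i → ∧-zeroʳ (opens i)) (upTo (2 * n))

  closed-zero : closed 0 ≡ 0
  closed-zero = count-false _ (λ i → ∧-zeroʳ (opens i)) (upTo (2 * n))

  opened+closed : ∀ j → j ≤ 2 * n → opened j + closed j ≡ j
  opened+closed zero    _    = cong₂ _+_ opened-zero closed-zero
  opened+closed (suc j) j<2n = begin
    opened (suc j) + closed (suc j)                           ≡⟨ cong₂ _+_ (opened-suc j j<2n) (closed-suc j j<2n) ⟩
    (opened j + ind (opens j)) + (closed j + ind (closes j))  ≡⟨ +-interchange (opened j) _ (closed j) _ ⟩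
    (opened j + closed j) + (ind (opens j) + ind (closes j))  ≡⟨ cong₂ _+_ (opened+closed j (<⇒≤ j<2n)) (opens+closes j j<2n) ⟩
    j + 1                                                     ≡⟨ +-comm j 1 ⟩
    suc j                                                     ∎
    where open ≡.≡-Reasoning

  cross-end : count (straddles (2 * n)) (edges p) ≡ 0
  cross-end = ≡.trans (count-edges (straddles (2 * n)))
    (≡.trans (count-cong-∈ (upTo (2 * n)) beyond) (count-false (λ _ → false) (λ _ → refl) (upTo (2 * n))))
    where
    beyond : ∀ i → i ∈ upTo (2 * n) → opens i ∧ straddles (2 * n) (i , partner i) ≡ false
    beyond i i∈ rewrite <ᵇ-false {2 * n} {suc (partner i)} (inRange i (∈-upTo⁻ i∈)) =
      ≡.trans (cong (opens i ∧_) (∧-zeroʳ (i <ᵇ 2 * n))) (∧-zeroʳ (opens i))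

  closed≡opened-end : closed (2 * n) ≡ opened (2 * n)
  closed≡opened-end = ≡.trans (cong (_+ closed (2 * n)) (≡.sym cross-end)) (cross+closed (2 * n))

  closed-end : closed (2 * n) ≡ n
  closed-end = half (≡.trans (cong (_+ closed (2 * n)) closed≡opened-end)
                    (≡.trans (opened+closed (2 * n) ≤-refl) (cong (n +_) (+-identityʳ n))))

  opened-end : opened (2 * n) ≡ n
  opened-end = ≡.trans (≡.sym closed≡opened-end) closed-end

  cross+index : ∀ j → j ≤ 2 * n → count (straddles j) (edges p) + j ≡ opened j + opened j
  cross+index j j≤2n = begin
    cross + j                       ≡⟨ cong (cross +_) (opened+closed j j≤2n) ⟨
    cross + (opened j + closed j)   ≡⟨ cong (cross +_) (+-comm (opened j) (closed j)) ⟩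
    cross + (closed j + opened j)   ≡⟨ +-assoc cross (closed j) (opened j) ⟨
    (cross + closed j) + opened j   ≡⟨ cong (_+ opened j) (cross+closed j) ⟩
    opened j + opened j             ∎
    where
    open ≡.≡-Reasoning
    cross = count (straddles j) (edges p)

-- The converse

ind≡0 : ∀ {b} → ind b ≡ 0 → b ≡ false
ind≡0 {false} _ = refl

ind≡1 : ∀ {b} → ind b ≡ 1 → b ≡ true
ind≡1 {true} _ = refl

count-zero : ∀ {A : Set} (g : A → Bool) {x} xs → count g xs ≡ 0 → x ∈ xs → g x ≡ false
count-zero g (y ∷ xs) none (here refl) = ind≡0 (m+n≡0⇒m≡0 (ind (g y)) none)
count-zero g (y ∷ xs) none (there x∈)  = count-zero g xs (m+n≡0⇒n≡0 (ind (g y)) none) x∈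

sum-zero : ∀ {A : Set} (f : A → ℕ) {x} xs → sum (map f xs) ≡ 0 → x ∈ xs → f x ≡ 0
sum-zero f (y ∷ xs) none (here refl) = m+n≡0⇒m≡0 (f y) none
sum-zero f (y ∷ xs) none (there x∈)  = sum-zero f xs (m+n≡0⇒n≡0 (f y) none) x∈

monotone : ∀ (f : ℕ → ℕ) m → (∀ i → i < m → f i ≤ f (suc i)) → ∀ {j k} → j ≤ k → k ≤ m → f j ≤ f k
monotone f m step {j} {zero}  z≤n _ = ≤-refl
monotone f m step {j} {suc k} j≤k k<m with m≤n⇒m<n∨m≡n j≤k
... | inj₁ (s≤s j≤k') = ≤-trans (monotone f m step j≤k' (<⇒≤ k<m)) (step k k<m)
... | inj₂ refl       = ≤-refl

at-ext : ∀ (xs ys : List ℕ) → length xs ≡ length ys → (∀ i → i < length xs → at xs i ≡ at ys i) → xs ≡ ys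
at-ext []       []       _   _  = refl
at-ext (x ∷ xs) (y ∷ ys) len eq =
  cong₂ _∷_ (eq 0 (s≤s z≤n)) (at-ext xs ys (suc-injective len) (λ i i<n → eq (suc i) (s≤s i<n)))

at-map : ∀ (f : ℕ → ℕ) xs i → i < length xs → at (map f xs) i ≡ f (at xs i)
at-map f (x ∷ xs) zero    _         = refl
at-map f (x ∷ xs) (suc i) (s≤s i<n) = at-map f xs i i<n

parity : ∀ x → ∃[ i ] (x ≡ 2 * i ⊎ x ≡ suc (2 * i))
parity zero    = 0 , inj₁ refl
parity (suc x) with parity x
... | i , inj₁ refl = i , inj₂ refl
... | i , inj₂ refl = suc i , inj₁ (≡.sym (*-suc 2 i))

2*-<-cancel : ∀ {i k} → 2 * i < 2 * k → i < k
2*-<-cancel {i} {k} 2i<2k with <ᵇ-cases i k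
... | inj₁ (i<k , _) = i<k
... | inj₂ (k≤i , _) = ⊥-elim (<-irrefl refl (≤-trans 2i<2k (*-monoʳ-≤ 2 k≤i)))

2*-suc-< : ∀ {i k} → i < k → suc (2 * i) < 2 * k
2*-suc-< {i} {k} i<k = ≡.subst (_≤ 2 * k) (*-suc 2 i) (*-monoʳ-≤ 2 i<k)

odd≢even : ∀ i n → suc (i + i) ≢ n + n
odd≢even zero    (suc n) e with ≡.trans (suc-injective e) (+-suc n n)
... | ()
odd≢even (suc i) (suc n) e =
  odd≢even i n (suc-injective (≡.trans (≡.sym (cong suc (+-suc i i))) (≡.trans (suc-injective e) (+-suc n n))))

mirror-< : ∀ {i m} → i < m → m ∸ suc i < m
mirror-< {i} {suc m} _ = s≤s (m∸n≤m m i)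

suc-∸-suc : ∀ {i m} → i < m → suc (m ∸ suc i) ≡ m ∸ i
suc-∸-suc {zero}  {suc m} _         = refl
suc-∸-suc {suc i} {suc m} (s≤s i<m) = suc-∸-suc i<m

mirror-mirror : ∀ {i m} → i < m → m ∸ suc (m ∸ suc i) ≡ i
mirror-mirror {i} {m} i<m = ≡.trans (cong (m ∸_) (suc-∸-suc i<m)) (m∸[m∸n]≡n (<⇒≤ i<m))

mirror-fixed : ∀ {i m} → i < m → m ∸ suc i ≡ i → suc (i + i) ≡ m
mirror-fixed {i} {m} i<m e = ≡.trans (cong (λ k → suc i + k) (≡.sym e)) (m+[n∸m]≡n i<m)

at-Mₙ : ∀ n i → i < 2 * n → at (Mₙ n) i ≡ 2 * n ∸ suc i
at-Mₙ n i i<2n = ≡.trans (cong (λ xs → at xs i) (map-upTo _ (2 * n))) (at-applyUpTo _ (2 * n) i i<2n)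

Mₙ-isMatching : ∀ n → IsMatching n (Mₙ n)
Mₙ-isMatching n = record
  { len     = length-Mₙ n
  ; inRange = λ i i<2n → ≡.subst (_< 2 * n) (≡.sym (at-Mₙ n i i<2n)) (mirror-< i<2n)
  ; noFix   = λ i i<2n e → odd≢even i n (≡.trans (mirror-fixed i<2n (≡.trans (≡.sym (at-Mₙ n i i<2n)) e))
                                                 (cong (n +_) (+-identityʳ n)))
  ; invol   = λ i i<2n → ≡.trans (cong (at (Mₙ n)) (at-Mₙ n i i<2n))
                           (≡.trans (at-Mₙ n _ (mirror-< i<2n)) (mirror-mirror i<2n))
  }

prepend-0 : ∀ {xs} → Linked _≤_ xs → Linked _≤_ (0 ∷ xs)
prepend-0 {[]}    _ = [-]
prepend-0 {_ ∷ _} l = z≤n ∷ l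

map-suc-linked : ∀ {xs} → Linked _≤_ xs → Linked _≤_ (map suc xs)
map-suc-linked []          = []
map-suc-linked [-]         = [-]
map-suc-linked (x≤y ∷ l)   = s≤s x≤y ∷ map-suc-linked l

staircase-sorted : ∀ n → Linked _≤_ (staircase n)
staircase-sorted zero    = [-]
staircase-sorted (suc n) = prepend-0 (prepend-0 (map-suc-linked (staircase-sorted n)))

length-staircase : ∀ n → length (staircase n) ≡ suc (2 * n)
length-staircase zero    = refl
length-staircase (suc n) = ≡.trans (cong (λ m → suc (suc m)) (≡.trans (length-map suc (staircase n)) (length-staircase n)))
                                   (cong suc (≡.sym (*-suc 2 n)))

at-staircase-even : ∀ n i → i ≤ n → at (staircase n) (2 * i) ≡ i
at-staircase-even zero    zero    _         = refl
at-staircase-even (suc n) zero    _         = refl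
at-staircase-even (suc n) (suc i) (s≤s i≤n) = begin
  at (staircase (suc n)) (2 * suc i)  ≡⟨ cong (at (staircase (suc n))) (*-suc 2 i) ⟩
  at (map suc (staircase n)) (2 * i)  ≡⟨ at-map suc (staircase n) (2 * i) 2i<|S| ⟩
  suc (at (staircase n) (2 * i))      ≡⟨ cong suc (at-staircase-even n i i≤n) ⟩
  suc i                               ∎
  where
  open ≡.≡-Reasoning
  2i<|S| = ≡.subst (2 * i <_) (≡.sym (length-staircase n)) (s≤s (*-monoʳ-≤ 2 i≤n))

at-staircase-odd : ∀ n i → i < n → at (staircase n) (suc (2 * i)) ≡ i
at-staircase-odd (suc n) zero    _         = refl
at-staircase-odd (suc n) (suc i) (s≤s i<n) = begin
  at (staircase (suc n)) (suc (2 * suc i))  ≡⟨ cong (λ j → at (staircase (suc n)) (suc j)) (*-suc 2 i) ⟩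
  at (map suc (staircase n)) (suc (2 * i))  ≡⟨ at-map suc (staircase n) (suc (2 * i)) 2i+1<|S| ⟩
  suc (at (staircase n) (suc (2 * i)))      ≡⟨ cong suc (at-staircase-odd n i i<n) ⟩
  suc i                                     ∎
  where
  open ≡.≡-Reasoning
  2i+1<|S| = ≡.subst (suc (2 * i) <_) (≡.sym (length-staircase n)) (m≤n⇒m≤1+n (2*-suc-< i<n))

at-Nₙ : ∀ n i → i < n → at (Nₙ n) (2 * i) ≡ suc (2 * i) × at (Nₙ n) (suc (2 * i)) ≡ 2 * i
at-Nₙ (suc n) zero    _         = cong (λ xs → at xs 0) (Nₙ-suc n) , cong (λ xs → at xs 1) (Nₙ-suc n)
at-Nₙ (suc n) (suc i) (s≤s i<n) with at-Nₙ n i i<n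
... | even , odd =
  ≡.trans (cong₂ at (Nₙ-suc n) (*-suc 2 i))
    (≡.trans (at-map (shiftAt 0) (Nₙ n) (2 * i) (≤-trans (n≤1+n (suc (2 * i))) 2i+1<|Nₙ|))
             (≡.trans (cong (λ v → suc (suc v)) even) (cong suc (≡.sym (*-suc 2 i))))) ,
  ≡.trans (cong₂ at (Nₙ-suc n) (cong suc (*-suc 2 i)))
    (≡.trans (at-map (shiftAt 0) (Nₙ n) (suc (2 * i)) 2i+1<|Nₙ|)
             (≡.trans (cong (λ v → suc (suc v)) odd) (≡.sym (*-suc 2 i))))
  where
  2i+1<|Nₙ| : suc (2 * i) < length (Nₙ n)
  2i+1<|Nₙ| = ≡.subst (suc (2 * i) <_) (≡.sym (length-Nₙ n)) (2*-suc-< i<n)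

true≢false : true ≢ false
true≢false ()

⊕-cancel : ∀ c {xs ys} → c ⊕ xs ↭ c ⊕ ys → xs ↭ ys
⊕-cancel c {xs} {ys} c⊕xs↭c⊕ys =
  ↭-trans (↭-reflexive (≡.sym (unshift xs))) (↭-trans (map⁺ (_∸ c) c⊕xs↭c⊕ys) (↭-reflexive (unshift ys)))
  where
  unshift : ∀ zs → map (_∸ c) (c ⊕ zs) ≡ zs
  unshift zs = ≡.trans (≡.sym (map-∘ zs)) (≡.trans (map-cong (m+n∸m≡n c) zs) (map-id zs))

pathWeights-one : ∀ br → (∀ h → map proj₁ (br h) ≡ h) → ∀ h → pathWeights br 1 h ≡ h
pathWeights-one br weights h = begin
  concatMap (λ q → [ proj₁ q + 0 ]) (br h)   ≡⟨ concatMap-map [_] (λ q → proj₁ q + 0) (br h) ⟨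
  concatMap [_] (map (λ q → proj₁ q + 0) (br h)) ≡⟨ concatMap-pure _ ⟩
  map (λ q → proj₁ q + 0) (br h)             ≡⟨ map-cong (λ q → +-identityʳ (proj₁ q)) (br h) ⟩
  map proj₁ (br h)                           ≡⟨ weights h ⟩
  h                                          ∎
  where open ≡.≡-Reasoning

crossBranching-weights : ∀ h → map proj₁ (crossBranching h) ≡ h
crossBranching-weights []      = refl
crossBranching-weights (x ∷ h) = cong (x ∷_) (≡.trans (≡.sym (map-∘ (crossBranching h))) (crossBranching-weights h))

nestBranching-weights : ∀ h → map proj₁ (nestBranching h) ≡ h
nestBranching-weights []      = refl
nestBranching-weights (x ∷ h) = cong (x ∷_) (≡.trans (≡.sym (map-∘ (nestBranching h))) (nestBranching-weights h))

profiles-↭ : ∀ {M N} → cr M ≡ ne N → map cr (𝒯 M 1) ↭ map ne (𝒯 N 1) → crossProfile M ↭ nestProfile N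
profiles-↭ {M} {N} cr≡ne 𝒯₁-↭ = ⊕-cancel (cr M) (begin
  cr M ⊕ crossProfile M                                   ≡⟨ cong (cr M ⊕_) (pathWeights-one crossBranching crossBranching-weights _) ⟨
  cr M ⊕ pathWeights crossBranching 1 (crossProfile M)    ↭⟨ cr-𝒯 1 M ⟨
  map cr (𝒯 M 1)                                          ↭⟨ 𝒯₁-↭ ⟩
  map ne (𝒯 N 1)                                          ↭⟨ ne-𝒯 1 N ⟩
  ne N ⊕ pathWeights nestBranching 1 (nestProfile N)      ≡⟨ cong₂ _⊕_ (≡.sym cr≡ne) (pathWeights-one nestBranching nestBranching-weights _) ⟩
  cr M ⊕ nestProfile N                                    ∎)
  where open PermutationReasoning

profile-cong : ∀ P {p q} → length p ≡ length q → (∀ j → j ≤ length p → count (P j) (edges p) ≡ count (P j) (edges q)) →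
  profile P p ≡ profile P q
profile-cong P {p} {q} |p|≡|q| agree =
  ≡.trans (map-cong-local (All.map (λ j<1+|p| → agree _ (≤-pred j<1+|p|)) (all-upTo (suc (length p)))))
          (cong (λ m → map (λ j → count (P j) (edges q)) (upTo (suc m))) |p|≡|q|)

crossProfile-determined : ∀ {n p q} (p-match : IsMatching n p) (q-match : IsMatching n q) →
  (∀ i → i < 2 * n → MatchingCounts.opens p-match i ≡ MatchingCounts.opens q-match i) → crossProfile p ≡ crossProfile q
crossProfile-determined {n} {p} {q} p-match q-match same-opens = profile-cong straddles {p} {q} (≡.trans P.len (≡.sym Q.len)) same-cross
  where
  module P = MatchingCounts p-match
  module Q = MatchingCounts q-match
  same-opened : ∀ j → j ≤ 2 * n → P.opened j ≡ Q.opened j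
  same-opened zero    _    = ≡.trans P.opened-zero (≡.sym Q.opened-zero)
  same-opened (suc j) j<2n = ≡.trans (P.opened-suc j j<2n)
    (≡.trans (cong₂ (λ a b → a + ind b) (same-opened j (<⇒≤ j<2n)) (same-opens j j<2n)) (≡.sym (Q.opened-suc j j<2n)))
  same-cross : ∀ j → j ≤ length p → count (straddles j) (edges p) ≡ count (straddles j) (edges q)
  same-cross j j≤|p| = +-cancelʳ-≡ j _ _ (begin
    count (straddles j) (edges p) + j  ≡⟨ P.cross+index j j≤2n ⟩
    P.opened j + P.opened j            ≡⟨ cong₂ _+_ (same-opened j j≤2n) (same-opened j j≤2n) ⟩
    Q.opened j + Q.opened j            ≡⟨ Q.cross+index j j≤2n ⟨
    count (straddles j) (edges q) + j  ∎)
    where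
    open ≡.≡-Reasoning
    j≤2n = ≤-trans j≤|p| (≤-reflexive P.len)

module _ {n M} (M-match : IsMatching n M) where

  open MatchingCounts M-match

  opened-mono : ∀ {j k} → j ≤ k → k ≤ 2 * n → opened j ≤ opened k
  opened-mono = monotone opened (2 * n) (λ i i<2n → ≤-trans (m≤m+n _ _) (≤-reflexive (≡.sym (opened-suc i i<2n))))

  closed-mono : ∀ {j k} → j ≤ k → k ≤ 2 * n → closed j ≤ closed k
  closed-mono = monotone closed (2 * n) (λ i i<2n → ≤-trans (m≤m+n _ _) (≤-reflexive (≡.sym (closed-suc i i<2n))))

  -- The gap crossed by n edges is the one after the first n vertices, which all open an edge.
  peak-position : n ∈ crossProfile M → opened n ≡ n × closed n ≡ 0
  peak-position n∈ with ∈-map⁻ (λ j → count (straddles j) (edges M)) n∈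
  ... | j , j∈ , n≡cross = ≡.subst (λ k → opened k ≡ n × closed k ≡ 0) j≡n (opened≡n , closed≡0)
    where
    j≤2n : j ≤ 2 * n
    j≤2n = ≤-trans (≤-pred (∈-upTo⁻ j∈)) (≤-reflexive len)
    n+closed≡opened : n + closed j ≡ opened j
    n+closed≡opened = ≡.trans (cong (_+ closed j) n≡cross) (cross+closed j)
    closed≡0 : closed j ≡ 0
    closed≡0 = n≤0⇒n≡0 (+-cancelˡ-≤ n (closed j) 0 (≤-trans (≤-reflexive n+closed≡opened)
                 (≤-trans (opened-mono j≤2n ≤-refl) (≤-reflexive (≡.trans opened-end (≡.sym (+-identityʳ n)))))))
    opened≡n : opened j ≡ n
    opened≡n = ≡.trans (≡.sym n+closed≡opened) (≡.trans (cong (n +_) closed≡0) (+-identityʳ n))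
    j≡n : j ≡ n
    j≡n = ≡.trans (≡.sym (opened+closed j j≤2n)) (≡.trans (cong₂ _+_ opened≡n closed≡0) (+-identityʳ n))

  opens-below : closed n ≡ 0 → ∀ i → i < n → opens i ≡ true
  opens-below closed-n≡0 i i<n = ind≡1 (begin
    ind (opens i)                      ≡⟨ +-identityʳ _ ⟨
    ind (opens i) + 0                  ≡⟨ cong (ind (opens i) +_) no-close ⟨
    ind (opens i) + ind (closes i)     ≡⟨ opens+closes i i<2n ⟩
    1                                  ∎)
    where
    open ≡.≡-Reasoning
    i<2n = ≤-trans i<n (m≤m+n n (n + 0))
    no-close : ind (closes i) ≡ 0
    no-close = m+n≡0⇒n≡0 (closed i) (≡.trans (≡.sym (closed-suc i i<2n))
      (n≤0⇒n≡0 (≤-trans (closed-mono i<n (m≤m+n n (n + 0))) (≤-reflexive closed-n≡0))))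

  opens-above : opened n ≡ n → ∀ i → n ≤ i → i < 2 * n → opens i ≡ false
  opens-above opened-n≡n i n≤i i<2n = ind≡0 (n≤0⇒n≡0 (+-cancelˡ-≤ (opened i) _ 0 (begin
    opened i + ind (opens i)  ≡⟨ opened-suc i i<2n ⟨
    opened (suc i)            ≤⟨ opened-mono i<2n ≤-refl ⟩
    opened (2 * n)            ≡⟨ opened-end ⟩
    n                         ≡⟨ opened-n≡n ⟨
    opened n                  ≤⟨ opened-mono n≤i (<⇒≤ i<2n) ⟩
    opened i                  ≡⟨ +-identityʳ (opened i) ⟨
    opened i + 0              ∎)))
    where open ≤-Reasoning

  peak⇒opens : n ∈ crossProfile M → ∀ i → i < 2 * n → opens i ≡ (i <ᵇ n)
  peak⇒opens n∈ i i<2n with <ᵇ-cases i n | peak-position n∈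
  ... | inj₁ (i<n , e) | _ , closed-n≡0 = ≡.trans (opens-below closed-n≡0 i i<n) (≡.sym e)
  ... | inj₂ (n≤i , e) | opened-n≡n , _ = ≡.trans (opens-above opened-n≡n i n≤i i<2n) (≡.sym e)

applyUpTo-linked : ∀ (f : ℕ → ℕ) k → (∀ i → i < k → f i ≤ f (suc i)) → Linked _≤_ (applyUpTo f (suc k))
applyUpTo-linked f zero    step = [-]
applyUpTo-linked f (suc k) step = step 0 (s≤s z≤n) ∷ applyUpTo-linked (λ i → f (suc i)) k (λ i i<k → step (suc i) (s≤s i<k))

sorted-↭-≡ : ∀ {xs ys} → Linked _≤_ xs → Linked _≤_ ys → xs ↭ ys → xs ≡ ys
sorted-↭-≡ xs↗ ys↗ xs↭ys = Pointwise-≡⇒≡ (Sorted.↗↭↗⇒≋ ≤-totalOrder xs↗ ys↗ (↭⇒↭ₛ xs↭ys))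

module _ {n N} (N-match : IsMatching n N) where

  open MatchingCounts N-match

  closed-at : ∀ j → j ≤ 2 * n → at (nestProfile N) j ≡ closed j
  closed-at j j≤2n = ≡.trans (at-profile endsBefore N j (≤-trans j≤2n (≤-reflexive (≡.sym len)))) (nest≡closed j)

  nestProfile-sorted : Linked _≤_ (nestProfile N)
  nestProfile-sorted = ≡.subst (Linked _≤_) (≡.sym (≡.trans (profile-applyUpTo endsBefore N) (applyUpTo-cong nest≡closed (suc (length N)))))
    (applyUpTo-linked closed (length N) (λ i i<|N| → ≤-trans (m≤m+n _ _) (≤-reflexive (≡.sym (closed-suc i (≤-trans i<|N| (≤-reflexive len)))))))

  module _ (staircase-profile : nestProfile N ≡ staircase n) where

    closed-staircase : ∀ j → j ≤ 2 * n → closed j ≡ at (staircase n) j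
    closed-staircase j j≤2n = ≡.trans (≡.sym (closed-at j j≤2n)) (cong (λ h → at h j) staircase-profile)

    closes-odd : ∀ i → i < n → closes (suc (2 * i)) ≡ true
    closes-odd i i<n = ind≡1 (+-cancelˡ-≡ i _ _ (begin
      i + ind (closes (suc (2 * i)))                      ≡⟨ cong (_+ ind (closes (suc (2 * i)))) closed-odd ⟨
      closed (suc (2 * i)) + ind (closes (suc (2 * i)))   ≡⟨ closed-suc (suc (2 * i)) (2*-suc-< i<n) ⟨
      closed (suc (suc (2 * i)))                          ≡⟨ closed-even ⟩
      suc i                                               ≡⟨ +-comm 1 i ⟩
      i + 1                                               ∎))
      where
      open ≡.≡-Reasoning
      closed-odd : closed (suc (2 * i)) ≡ i
      closed-odd = ≡.trans (closed-staircase (suc (2 * i)) (<⇒≤ (2*-suc-< i<n))) (at-staircase-odd n i i<n)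
      closed-even : closed (suc (suc (2 * i))) ≡ suc i
      closed-even = ≡.trans (cong closed (≡.sym (*-suc 2 i)))
                   (≡.trans (closed-staircase (2 * suc i) (*-monoʳ-≤ 2 i<n)) (at-staircase-even n (suc i) i<n))

    opens-odd : ∀ i → i < n → opens (suc (2 * i)) ≡ false
    opens-odd i i<n = ind≡0 (+-cancelʳ-≡ 1 _ _ (≡.trans (cong (λ b → ind (opens (suc (2 * i))) + ind b) (≡.sym (closes-odd i i<n)))
                                                         (opens+closes (suc (2 * i)) (2*-suc-< i<n))))

    -- The partner of 2i+1 is an earlier opener, hence even, and the smaller even vertices are taken.
    partner-odd : ∀ i → i < n → partner (suc (2 * i)) ≡ 2 * i
    partner-odd = <-rec (λ i → i < n → partner (suc (2 * i)) ≡ 2 * i) step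
      where
      step : ∀ i → (∀ {i'} → i' < i → i' < n → partner (suc (2 * i')) ≡ 2 * i') → i < n → partner (suc (2 * i)) ≡ 2 * i
      step i earlier i<n = from-parity (parity a)
        where
        a = partner (suc (2 * i))
        a<2i+1 : a < suc (2 * i)
        a<2i+1 = <ᵇ-true⁻ (closes-odd i i<n)
        a-opens : opens a ≡ true
        a-opens = ≡.trans (cong (a <ᵇ_) (invol _ (2*-suc-< i<n))) (<ᵇ-true a<2i+1)
        from-parity : ∃[ i' ] (a ≡ 2 * i' ⊎ a ≡ suc (2 * i')) → a ≡ 2 * i
        from-parity (i' , inj₂ a≡odd) = ⊥-elim (true≢false (≡.trans (≡.sym a-opens) (≡.trans (cong opens a≡odd) (opens-odd i' i'<n))))
          where i'<n = 2*-<-cancel {i'} {n} (≤-trans (n≤1+n _) (≡.subst (_< 2 * n) a≡odd (inRange _ (2*-suc-< i<n))))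
        from-parity (i' , inj₁ a≡even) = from-order (m≤n⇒m<n∨m≡n (*-cancelˡ-≤ 2 (≤-pred (≡.subst (_< suc (2 * i)) a≡even a<2i+1))))
          where
          from-order : i' < i ⊎ i' ≡ i → a ≡ 2 * i
          from-order (inj₂ i'≡i) = ≡.trans a≡even (cong (2 *_) i'≡i)
          from-order (inj₁ i'<i) = ⊥-elim (<-irrefl (*-cancelˡ-≡ i' i 2 (suc-injective (≡.trans (≡.sym partner-2i') partner-a))) i'<i)
            where
            partner-2i' : partner (2 * i') ≡ suc (2 * i')
            partner-2i' = ≡.trans (cong partner (≡.sym (earlier i'<i (<-trans i'<i i<n)))) (invol _ (2*-suc-< (<-trans i'<i i<n)))
            partner-a : partner (2 * i') ≡ suc (2 * i)
            partner-a = ≡.trans (cong partner (≡.sym a≡even)) (invol _ (2*-suc-< i<n))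

    N≡Nₙ : N ≡ Nₙ n
    N≡Nₙ = at-ext N (Nₙ n) (≡.trans len (≡.sym (length-Nₙ n))) (λ x x<|N| → by-parity x (≤-trans x<|N| (≤-reflexive len)) (parity x))
      where
      by-parity : ∀ x → x < 2 * n → ∃[ i ] (x ≡ 2 * i ⊎ x ≡ suc (2 * i)) → partner x ≡ at (Nₙ n) x
      by-parity x x<2n (i , inj₁ refl) = ≡.trans (≡.trans (cong partner (≡.sym (partner-odd i i<n))) (invol _ (2*-suc-< i<n)))
                                                 (≡.sym (proj₁ (at-Nₙ n i i<n)))
        where i<n = 2*-<-cancel x<2n
      by-parity x x<2n (i , inj₂ refl) = ≡.trans (partner-odd i i<n) (≡.sym (proj₂ (at-Nₙ n i i<n)))
        where i<n = 2*-<-cancel (≤-trans (n≤1+n _) x<2n)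

crosses-true : ∀ {a b c d} → a < c → c < b → b < d → crosses (a , b) (c , d) ≡ true
crosses-true a<c c<b b<d rewrite <ᵇ-true a<c | <ᵇ-true c<b | <ᵇ-true b<d = refl

module _ {n M} (M-match : IsMatching n M) (opens-first : ∀ i → i < 2 * n → MatchingCounts.opens M-match i ≡ (i <ᵇ n))
         (noncrossing : cr M ≡ 0) where

  open MatchingCounts M-match

  i<2n : ∀ {i} → i < n → i < 2 * n
  i<2n i<n = ≤-trans i<n (m≤m+n _ _)

  opener : ∀ {a} → a < n → a < partner a
  opener a<n = <ᵇ-true⁻ (≡.trans (opens-first _ (i<2n a<n)) (<ᵇ-true a<n))

  edge∈ : ∀ {a} → a < n → (a , partner a) ∈ edges M
  edge∈ {a} a<n = ∈-map⁺ (λ i → (i , partner i)) (∈-filter⁺ (λ i → i <? partner i)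
                    (∈-upTo⁺ (≤-trans (i<2n a<n) (≤-reflexive (≡.sym len)))) (opener a<n))

  no-crossing : ∀ {a a'} → a < n → a' < n → crosses (a , partner a) (a' , partner a') ≡ false
  no-crossing a<n a'<n = count-zero (crosses (_ , partner _)) (edges M)
    (sum-zero (λ e → count (crosses e) (edges M)) (edges M) noncrossing (edge∈ a<n)) (edge∈ a'<n)

  closes-late : ∀ {a} → a < n → n ≤ partner a
  closes-late {a} a<n = <ᵇ-false⁻ (≡.trans (≡.sym (opens-first _ (inRange a (i<2n a<n))))
    (≡.trans (cong (partner a <ᵇ_) (invol a (i<2n a<n))) (<ᵇ-false (<⇒≤ (opener a<n)))))

  -- Otherwise the edges at a and a' would cross.
  partner-decreasing : ∀ {a a'} → a < a' → a' < n → partner a' < partner a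
  partner-decreasing {a} {a'} a<a' a'<n with <-cmp (partner a) (partner a')
  ... | tri> _ _ Pa'<Pa = Pa'<Pa
  ... | tri≈ _ Pa≡Pa' _ = ⊥-elim (<-irrefl (≡.trans (≡.sym (invol a (i<2n a<n))) (≡.trans (cong partner Pa≡Pa') (invol a' (i<2n a'<n)))) a<a')
    where a<n = <-trans a<a' a'<n
  ... | tri< Pa<Pa' _ _ = ⊥-elim (true≢false (≡.trans (≡.sym (crosses-true a<a' (≤-trans a'<n (closes-late a<n)) Pa<Pa')) (no-crossing a<n a'<n)))
    where a<n = <-trans a<a' a'<n

  <-of-+-suc : ∀ i d → i + suc d ≡ n → i < n
  <-of-+-suc i d e = ≤-trans (s≤s (m≤m+n i d)) (≤-reflexive (≡.trans (≡.sym (+-suc i d)) e))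

  partner-upper : ∀ i → i < n → suc (partner i + i) ≤ 2 * n
  partner-upper zero    0<n   = ≡.subst (λ k → suc k ≤ 2 * n) (≡.sym (+-identityʳ (partner 0))) (inRange 0 (i<2n 0<n))
  partner-upper (suc i) 1+i<n = begin
    suc (partner (suc i) + suc i)    ≡⟨ cong suc (+-suc (partner (suc i)) i) ⟩
    suc (suc (partner (suc i) + i))  ≤⟨ s≤s (+-monoˡ-≤ i (partner-decreasing (n<1+n i) 1+i<n)) ⟩
    suc (partner i + i)              ≤⟨ partner-upper i (<-trans (n<1+n i) 1+i<n) ⟩
    2 * n                            ∎
    where open ≤-Reasoning

  partner-lower : ∀ d i → i + suc d ≡ n → n + d ≤ partner i
  partner-lower zero    i e = ≡.subst (_≤ partner i) (≡.sym (+-identityʳ n)) (closes-late (<-of-+-suc i 0 e))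
  partner-lower (suc d) i e = begin
    n + suc d             ≡⟨ +-suc n d ⟩
    suc (n + d)           ≤⟨ s≤s (partner-lower d (suc i) e') ⟩
    suc (partner (suc i)) ≤⟨ partner-decreasing (n<1+n i) (<-of-+-suc (suc i) d e') ⟩
    partner i             ∎
    where
    open ≤-Reasoning
    e' : suc i + suc d ≡ n
    e' = ≡.trans (≡.sym (+-suc i (suc d))) e

  -- A decreasing map from the first n vertices to the last n ones is the reflection.
  partner-sum : ∀ i → i < n → suc (partner i + i) ≡ 2 * n
  partner-sum i i<n = ≤-antisym (partner-upper i i<n) (begin
    2 * n                  ≡⟨ cong (n +_) (+-identityʳ n) ⟩
    n + n                  ≡⟨ cong (n +_) e ⟨
    n + (suc i + d)        ≡⟨ +-suc n (i + d) ⟩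
    suc (n + (i + d))      ≡⟨ cong (λ k → suc (n + k)) (+-comm i d) ⟩
    suc (n + (d + i))      ≡⟨ cong suc (+-assoc n d i) ⟨
    suc (n + d + i)        ≤⟨ s≤s (+-monoˡ-≤ i (partner-lower d i (≡.trans (+-suc i d) e))) ⟩
    suc (partner i + i)    ∎)
    where
    open ≤-Reasoning
    d = n ∸ suc i
    e : suc i + d ≡ n
    e = m+[n∸m]≡n i<n

  partner-mirror : ∀ i → i < 2 * n → partner i ≡ 2 * n ∸ suc i
  partner-mirror i i<2n with <ᵇ-cases i n
  ... | inj₁ (i<n , _) = ≡.sym (≡.trans (cong (_∸ suc i) (≡.sym (partner-sum i i<n))) (m+n∸n≡m (partner i) i))
  ... | inj₂ (n≤i , e) = ≡.sym (≡.trans (cong (_∸ suc i) (≡.sym (≡.trans (cong (λ k → suc (k + a)) (≡.sym (invol i i<2n))) (partner-sum a a<n))))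
                                        (m+n∸m≡n i a))
    where
    a = partner i
    i-closes : closes i ≡ true
    i-closes = ind≡1 (≡.trans (cong (λ b → ind b + ind (closes i)) (≡.sym (≡.trans (opens-first i i<2n) e))) (opens+closes i i<2n))
    a-opens : opens a ≡ true
    a-opens = ≡.trans (cong (a <ᵇ_) (invol i i<2n)) i-closes
    a<n : a < n
    a<n = <ᵇ-true⁻ (≡.trans (≡.sym (opens-first a (inRange i i<2n))) a-opens)

  M≡Mₙ : M ≡ Mₙ n
  M≡Mₙ = at-ext M (Mₙ n) (≡.trans len (≡.sym (length-Mₙ n)))
    (λ i i<|M| → let i<2n = ≤-trans i<|M| (≤-reflexive len) in ≡.trans (partner-mirror i i<2n) (≡.sym (at-Mₙ n i i<2n)))

pyramid-peak : ∀ n → n ∈ pyramid n ++ [ 0 ]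
pyramid-peak zero    = here refl
pyramid-peak (suc n) = there (∈-++⁺ˡ (∈-map⁺ suc (pyramid-peak n)))

nest-peak : ∀ {n N} → IsMatching n N → n ∈ nestProfile N
nest-peak {n} {N} N-match = ≡.subst (_∈ nestProfile N) (≡.trans (nest≡closed (2 * n)) closed-end)
  (∈-map⁺ (λ j → count (endsBefore j) (edges N)) (∈-upTo⁺ (s≤s (≤-reflexive (≡.sym len)))))
  where open MatchingCounts N-match

module _ {n M N} (M-match : IsMatching n M) (N-match : IsMatching n N) (profiles : crossProfile M ↭ nestProfile N) where

  opens-first : ∀ i → i < 2 * n → MatchingCounts.opens M-match i ≡ (i <ᵇ n)
  opens-first = peak⇒opens M-match (∈-resp-↭ (↭-sym profiles) (nest-peak N-match))

  nestProfile≡staircase : nestProfile N ≡ staircase n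
  nestProfile≡staircase = sorted-↭-≡ (nestProfile-sorted N-match) (staircase-sorted n) (begin
    nestProfile N       ↭⟨ ↭-sym profiles ⟩
    crossProfile M      ≡⟨ crossProfile-determined M-match (Mₙ-isMatching n) (λ i i<2n → ≡.trans (opens-first i i<2n) (≡.sym (opens-Mₙ i i<2n))) ⟩
    crossProfile (Mₙ n) ≡⟨ crossProfile-Mₙ n ⟩
    pyramid n ++ [ 0 ]  ↭⟨ pyramid-↭-staircase n ⟩
    staircase n         ∎)
    where
    open PermutationReasoning
    opens-Mₙ : ∀ i → i < 2 * n → MatchingCounts.opens (Mₙ-isMatching n) i ≡ (i <ᵇ n)
    opens-Mₙ = peak⇒opens (Mₙ-isMatching n) (≡.subst (n ∈_) (≡.sym (crossProfile-Mₙ n)) (pyramid-peak n))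

proposition4p1 : (n : ℕ) (M N : List ℕ) → IsMatching n M → IsMatching n N →
    ((∀ (l : ℕ) → map cr (𝒯 M l) ↭ map ne (𝒯 N l)) ⇔ (M ≡ Mₙ n × N ≡ Nₙ n))
proposition4p1 n M N M-match N-match = mk⇔ extremal (λ { (refl , refl) → 𝒯-Mₙ-Nₙ n })
  where
  extremal : (∀ l → map cr (𝒯 M l) ↭ map ne (𝒯 N l)) → M ≡ Mₙ n × N ≡ Nₙ n
  extremal 𝒯-↭ = M≡Mₙ M-match (opens-first M-match N-match profiles) noncrossing , N≡Nₙ′
    where
    cr≡ne : cr M ≡ ne N
    cr≡ne = ∷-injectiveˡ (↭-singleton-inv (𝒯-↭ 0))
    profiles : crossProfile M ↭ nestProfile N
    profiles = profiles-↭ cr≡ne (𝒯-↭ 1)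
    N≡Nₙ′ : N ≡ Nₙ n
    N≡Nₙ′ = N≡Nₙ N-match (nestProfile≡staircase M-match N-match profiles)
    noncrossing : cr M ≡ 0
    noncrossing = ≡.trans cr≡ne (≡.trans (cong ne N≡Nₙ′) (ne-Nₙ n))
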